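{- Let $n>2$ with $n=p^\alpha q^\beta$, where $p,q$ are primes and $\alpha,\beta$ are non-negative integers. Then the comaximal graph $\Gamma(\mathbb{Z}_n)$ is Laplacian integral, i.e. all eigenvalues of its Laplacian matrix are integers.
   Context: The comaximal graph $\Gamma(\mathbb{Z}_n)$ has vertex set $\mathbb{Z}_n=\{0,1,\dots,n-1\}$, distinct $x,y$ adjacent iff $\langle x\rangle+\langle y\rangle=\mathbb{Z}_n$. Its Laplacian matrix is $L=D-A$ ($D$ diagonal degree matrix, $A$ adjacency matrix). -}

module Defs where

open import Data.Nat as ℕ using (ℕ; zero; suc)
open import Data.Nat.DivMod using (_%_)
open import Data.Nat.Properties using () renaming (_≟_ to _≟ℕ_)
open import Data.Fin using (Fin; zero; suc; toℕ; punchIn)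
open import Data.Fin.Properties using (any?) renaming (_≟_ to _≟F_)
open import Data.Integer as ℤ using (ℤ; +_; _-_; _*_; -_)
open import Data.Product using (Σ; ∃; _,_; _×_)
open import Relation.Binary.PropositionalEquality using (_≡_)
open import Relation.Nullary using (Dec; yes; no; ¬_)
open import Relation.Nullary.Decidable using (_×-dec_; ¬?)

-- The ring ℤ_n is modelled by residues Fin n = {0,…,n-1}.
-- x,y ∈ ℤ_n are comaximal (⟨x⟩ + ⟨y⟩ = ℤ_n) iff 1 ∈ ⟨x⟩ + ⟨y⟩, i.e.
-- there are a,b ∈ ℤ_n with a·x + b·y ≡ 1 (mod n).
Comaximal : (n : ℕ) → Fin n → Fin n → Set
Comaximal zero    x y = Σ (Fin zero) λ _ → Fin zero
Comaximal (suc m) x y =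
  Σ (Fin (suc m)) λ a → Σ (Fin (suc m)) λ b →
    ((toℕ a ℕ.* toℕ x ℕ.+ toℕ b ℕ.* toℕ y) % suc m) ≡ (1 % suc m)

comaximal? : (n : ℕ) → (x y : Fin n) → Dec (Comaximal n x y)
comaximal? zero    () y
comaximal? (suc m) x y =
  any? λ a → any? λ b →
    ((toℕ a ℕ.* toℕ x ℕ.+ toℕ b ℕ.* toℕ y) % suc m) ≟ℕ (1 % suc m)

Adjacent : (n : ℕ) → Fin n → Fin n → Set
Adjacent n x y = (¬ (x ≡ y)) × Comaximal n x y

adjacent? : (n : ℕ) → (x y : Fin n) → Dec (Adjacent n x y)
adjacent? n x y = ¬? (x ≟F y) ×-dec comaximal? n x y

sumFin : ∀ {n} → (Fin n → ℤ) → ℤ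
sumFin {zero}  f = + 0
sumFin {suc n} f = f zero ℤ.+ sumFin (λ i → f (suc i))

prodFin : ∀ {n} → (Fin n → ℤ) → ℤ
prodFin {zero}  f = + 1
prodFin {suc n} f = f zero * prodFin (λ i → f (suc i))

Matrix : ℕ → Set
Matrix n = Fin n → Fin n → ℤ

sign : ∀ {n} → Fin n → ℤ
sign zero    = + 1
sign (suc i) = - sign i

det : ∀ {n} → Matrix n → ℤ
det {zero}  M = + 1
det {suc n} M =
  sumFin λ j → sign j * M zero j * det (λ r c → M (suc r) (punchIn j c))

adjacency : (n : ℕ) → Matrix n
adjacency n x y with adjacent? n x y
... | yes _ = + 1
... | no  _ = + 0

degree : (n : ℕ) → Fin n → ℤ
degree n x = sumFin (adjacency n x)

δ : ∀ {n} → Fin n → Fin n → ℤ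
δ i j with i ≟F j
... | yes _ = + 1
... | no  _ = + 0

laplacian : (n : ℕ) → Matrix n
laplacian n x y = degree n x * δ x y - adjacency n x y

charPoly : ∀ {n} → Matrix n → ℤ → ℤ
charPoly M t = det (λ i j → t * δ i j - M i j)

-- M is integral: its characteristic polynomial (monic, degree n) is
-- ∏ (t - λ_i) for some integers λ_1,…,λ_n, i.e. all its eigenvalues
-- (the roots of det(tI - M), with multiplicity) are integers.
-- Equality as polynomial functions on ℤ is equality of polynomials.
IntegralSpectrum : ∀ {n} → Matrix n → Set
IntegralSpectrum {n} M =
  Σ (Fin n → ℤ) λ ev → ∀ (t : ℤ) → charPoly M t ≡ prodFin (λ i → t - ev i)

LaplacianIntegral : ℕ → Set
LaplacianIntegral n = IntegralSpectrum (laplacian n)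

{-# OPTIONS --safe #-}

-- Write n = P^α·Q^β and call the pair (P ∣ x, Q ∣ x) the kind of a residue x. Distinct residues
-- are comaximal iff neither P nor Q divides both, so tI − L is a "typed" matrix: its (x, y) entry
-- is d(kind x)·δ(x, y) + K(kind x, kind y)·w(y), with all weights w = 1 and
-- d(κ) = t − #{y : K(κ, kind y) = 1}. For two vertices of the same kind, subtracting one row from
-- the other and adding the matching column back splits off the factor d(κ) and merges the two
-- vertices, adding their weights. Merging every residue into a representative of its kind
-- (0, 1, P, Q) leaves one integer eigenvalue per merged residue times the determinant of a 2×2
-- or 4×4 quotient matrix, which factors as t(t − n), resp. t(t − n)(t − u − a − b)(t − u) with
-- u units and a, b residues divisible by P only, resp. by Q only.
module Submission where

open import Defs

open import Algebra.Properties.CommutativeMonoid.Sum as CommutativeMonoidSum using ()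
open import Algebra.Properties.Semiring.Sum as SemiringSum using ()
open import Data.Bool as Bool using (Bool; true; false; if_then_else_; not; _∧_)
open import Data.Empty using (⊥-elim)
open import Data.Fin as Fin using (Fin; zero; suc; toℕ; fromℕ<; punchIn; punchOut)
open import Data.Fin.Properties
  using ( any?; suc-injective; toℕ-injective; toℕ-fromℕ<; <-cmp; <⇒≢; ≤∧≢⇒<; cantor-schröder-bernstein
        ; punchIn-injective; punchInᵢ≢i; punchIn-punchOut; punchOut-punchIn; punchOut-cong
        ; punchOut-mono-≤; punchOut-injective )
  renaming (_≟_ to _≟F_)
open import Data.Integer as ℤ using (ℤ; +_; -_; _+_; _*_; _-_)
import Data.Integer.Properties as ℤP
open import Algebra.Properties.AbelianGroup ℤP.+-0-abelianGroup using () renaming (∙-cancelˡ to +-cancelˡ)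
open import Data.Integer.Tactic.RingSolver using (solve-∀; ring)
open import Data.Nat as ℕ using (ℕ; _^_; nonTrivial⇒n>1)
open import Data.Nat.Coprimality using (Coprime; coprime-Bézout; coprime-divisor)
open import Data.Nat.Divisibility
  using (_∣_; _∣?_; _∣0; ∣-refl; ∣⇒≤; ∣-trans; ∣1⇒≡1; ∣m∣n⇒∣m+n; ∣m+n∣m⇒∣n; ∣n⇒∣m*n; ∣m⇒∣m*n; m∣m*n)
open import Data.Nat.DivMod using (_%_; _/_; m≡m%n+[m/n]*n; [m+kn]%n≡m%n; m%n<n; m<n⇒m%n≡m; %-distribˡ-*)
open import Data.Nat.GCD using (module Bézout; gcd; gcd-GCD; gcd[m,n]∣m; gcd[m,n]∣n)
open import Data.Nat.Primality using (Prime; prime⇒irreducible; prime⇒nonZero; prime⇒nonTrivial; ¬prime[1])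
import Data.Nat.Properties as ℕP
import Data.Nat.Tactic.RingSolver as ℕ-Solver
open import Data.Product using (∃; ∃₂; _×_; _,_; proj₁; proj₂)
open import Data.Product.Properties using (≡-dec)
open import Data.Sum using (inj₁; inj₂)
open import Data.Vec using (Vec; _∷_; tabulate)
open import Data.Vec.Functional using (removeAt)
open import Data.Vec.Properties using (lookup∘tabulate)
open import Function using (_∘_; _⇔_; mk⇔; Equivalence)
open import Relation.Binary using (tri<; tri≈; tri>)
open import Relation.Binary.Definitions using (DecidableEquality)
open import Relation.Binary.PropositionalEquality
open import Relation.Nullary using (yes; no; ¬_; Dec; ¬?; does)
open import Relation.Nullary.Decidable using (decidable-stable; _×-dec_; dec-true; dec-false)
open import Tactic.RingSolver.NonReflective ring using (Expr; Κ; Ι; _⊕_; _⊗_; ⊝_; module Ops)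

module Σℤ = SemiringSum ℤP.+-*-semiring
module Πℤ = CommutativeMonoidSum ℤP.*-1-commutativeMonoid

sumFin≡sum : ∀ {n} (f : Fin n → ℤ) → sumFin f ≡ Σℤ.sum f
sumFin≡sum {ℕ.zero}  f = refl
sumFin≡sum {ℕ.suc n} f = cong (_+_ (f zero)) (sumFin≡sum (f ∘ suc))

prodFin≡product : ∀ {n} (f : Fin n → ℤ) → prodFin f ≡ Πℤ.sum f
prodFin≡product {ℕ.zero}  f = refl
prodFin≡product {ℕ.suc n} f = cong (f zero *_) (prodFin≡product (f ∘ suc))

module _ {n : ℕ} where

  Σ-cong : {f g : Fin n → ℤ} → (∀ i → f i ≡ g i) → sumFin f ≡ sumFin g
  Σ-cong {f} {g} e = trans (sumFin≡sum f) (trans (Σℤ.sum-cong-≗ {x = f} {y = g} e) (sym (sumFin≡sum g)))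

  Σ-distrib-+ : (f g : Fin n → ℤ) → sumFin (λ i → f i + g i) ≡ sumFin f + sumFin g
  Σ-distrib-+ f g = trans (sumFin≡sum (λ i → f i + g i))
    (trans (Σℤ.∑-distrib-+ f g) (sym (cong₂ _+_ (sumFin≡sum f) (sumFin≡sum g))))

  *-distribˡ-Σ : (c : ℤ) (f : Fin n → ℤ) → c * sumFin f ≡ sumFin (λ i → c * f i)
  *-distribˡ-Σ c f = trans (cong (c *_) (sumFin≡sum f))
    (trans (Σℤ.*-distribˡ-sum c f) (sym (sumFin≡sum (λ i → c * f i))))

  Σ-zero : (f : Fin n → ℤ) → (∀ i → f i ≡ + 0) → sumFin f ≡ + 0
  Σ-zero f e = trans (Σ-cong e) (trans (sumFin≡sum {n} (λ _ → + 0)) (Σℤ.sum-replicate-zero n))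

Σ-swap : ∀ {m n} (f : Fin m → Fin n → ℤ) →
         sumFin (λ i → sumFin (f i)) ≡ sumFin (λ j → sumFin (λ i → f i j))
Σ-swap f = trans (double f) (trans (Σℤ.∑-comm f) (sym (double (λ j i → f i j))))
  where
  double : ∀ {k l} (g : Fin k → Fin l → ℤ) → sumFin (λ i → sumFin (g i)) ≡ Σℤ.sum (λ i → Σℤ.sum (g i))
  double {k} g = trans (sumFin≡sum {k} (λ i → sumFin (g i)))
    (Σℤ.sum-cong-≗ {x = λ i → sumFin (g i)} {y = λ i → Σℤ.sum (g i)} (λ i → sumFin≡sum (g i)))

Σ-remove : ∀ {n} (f : Fin (ℕ.suc n) → ℤ) (k : Fin (ℕ.suc n)) →
           sumFin f ≡ f k + sumFin (removeAt f k)
Σ-remove f k = trans (sumFin≡sum f)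
  (trans (Σℤ.sum-remove f) (sym (cong (_+_ (f k)) (sumFin≡sum (removeAt f k)))))

Σ-single : ∀ {n} (f : Fin n → ℤ) (k : Fin n) → (∀ j → j ≢ k → f j ≡ + 0) → sumFin f ≡ f k
Σ-single {ℕ.suc n} f k e = begin
  sumFin f                      ≡⟨ Σ-remove f k ⟩
  f k + sumFin (removeAt f k)   ≡⟨ cong (_+_ (f k)) (Σ-zero _ (λ j → e _ (punchInᵢ≢i k j))) ⟩
  f k + + 0                     ≡⟨ ℤP.+-identityʳ (f k) ⟩
  f k                           ∎
  where open ≡-Reasoning

Π-cong : ∀ {n} {f g : Fin n → ℤ} → (∀ i → f i ≡ g i) → prodFin f ≡ prodFin g
Π-cong {n} {f} {g} e = trans (prodFin≡product f)
  (trans (Πℤ.sum-cong-≗ {x = f} {y = g} e) (sym (prodFin≡product g)))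

Π-remove : ∀ {n} (f : Fin (ℕ.suc n) → ℤ) (k : Fin (ℕ.suc n)) →
           prodFin f ≡ f k * prodFin (removeAt f k)
Π-remove f k = trans (prodFin≡product f)
  (trans (Πℤ.sum-remove f) (sym (cong (f k *_) (prodFin≡product (removeAt f k)))))

-- Determinants

δ-refl : ∀ {n} (i : Fin n) → δ i i ≡ + 1
δ-refl i with i ≟F i
... | yes _ = refl
... | no i≢i = ⊥-elim (i≢i refl)

δ-≢ : ∀ {n} {i j : Fin n} → i ≢ j → δ i j ≡ + 0
δ-≢ {i = i} {j} i≢j with i ≟F j
... | yes i≡j = ⊥-elim (i≢j i≡j)
... | no _ = refl

δ-punchIn : ∀ {n} (l : Fin (ℕ.suc n)) (j c : Fin n) → δ (punchIn l j) (punchIn l c) ≡ δ j c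
δ-punchIn l j c with j ≟F c
... | yes refl = δ-refl (punchIn l j)
... | no j≢c = δ-≢ (j≢c ∘ punchIn-injective l j c)

𝟙 : ∀ {A : Set} → Dec A → ℤ
𝟙 a? = if does a? then + 1 else + 0

𝟙-⇔ : ∀ {A B : Set} → A ⇔ B → (a? : Dec A) (b? : Dec B) → 𝟙 a? ≡ 𝟙 b?
𝟙-⇔ A⇔B (yes _) (yes _) = refl
𝟙-⇔ A⇔B (no _) (no _) = refl
𝟙-⇔ A⇔B (yes a) (no ¬b) = ⊥-elim (¬b (Equivalence.to A⇔B a))
𝟙-⇔ A⇔B (no ¬a) (yes b) = ⊥-elim (¬a (Equivalence.from A⇔B b))

𝟙-¬×-dec : ∀ {A B : Set} (a? : Dec A) (b? : Dec B) → 𝟙 (¬? a? ×-dec b?) ≡ (+ 1 - 𝟙 a?) * 𝟙 b?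
𝟙-¬×-dec a? b? with does a? | does b?
... | true | true = refl
... | true | false = refl
... | false | true = refl
... | false | false = refl

δ≡𝟙 : ∀ {n} (i j : Fin n) → δ i j ≡ 𝟙 (i ≟F j)
δ≡𝟙 i j with i ≟F j
... | yes _ = refl
... | no _ = refl

δ-diagonal : ∀ {n} (f : Fin n → ℤ) i j → f i * δ i j ≡ f j * δ i j
δ-diagonal f i j with i ≟F j
... | yes refl = refl
... | no _ = trans (ℤP.*-zeroʳ (f i)) (sym (ℤP.*-zeroʳ (f j)))

sign-square : ∀ {n} (i : Fin n) → sign i * sign i ≡ + 1
sign-square zero = refl
sign-square (suc i) = trans (neg-square (sign i)) (sign-square i)
  where
  neg-square : ∀ a → (- a) * (- a) ≡ a * a
  neg-square = solve-∀

minor : ∀ {A : Set} {n} → (Fin (ℕ.suc n) → Fin (ℕ.suc n) → A) → Fin (ℕ.suc n) → Fin (ℕ.suc n) →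
        Fin n → Fin n → A
minor M i k r c = M (punchIn i r) (punchIn k c)

_ᵀ : ∀ {n} → Matrix n → Matrix n
(M ᵀ) i j = M j i

det-cong : ∀ {n} {M N : Matrix n} → (∀ i j → M i j ≡ N i j) → det M ≡ det N
det-cong {ℕ.zero} e = refl
det-cong {ℕ.suc n} e =
  Σ-cong (λ j → cong₂ _*_ (cong (sign j *_) (e zero j)) (det-cong (λ r c → e (suc r) (punchIn j c))))

det-expand-col₀ : ∀ {n} (M : Matrix (ℕ.suc n)) →
                  det M ≡ sumFin (λ i → sign i * M i zero * det (minor M i zero))
det-expand-col₀ {ℕ.zero} M = refl
det-expand-col₀ {ℕ.suc n} M =
  cong (_+_ (sign {ℕ.suc (ℕ.suc n)} zero * M zero zero * det (minor M zero zero))) tail-terms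
  where
  open ≡-Reasoning
  D : Fin (ℕ.suc n) → Fin (ℕ.suc n) → ℤ
  D i k = det (minor (minor M zero zero) i k)
  reorder : ∀ sk ak si bi d → (- sk) * ak * (si * bi * d) ≡ (- si) * bi * (sk * ak * d)
  reorder = solve-∀
  tail-terms : sumFin (λ k → sign (suc k) * M zero (suc k) * det (minor M zero (suc k)))
             ≡ sumFin (λ i → sign (suc i) * M (suc i) zero * det (minor M (suc i) zero))
  tail-terms = begin
      sumFin (λ k → (- sign k) * M zero (suc k) * det (minor M zero (suc k)))
    ≡⟨ Σ-cong (λ k → cong ((- sign k) * M zero (suc k) *_) (det-expand-col₀ (minor M zero (suc k)))) ⟩
      sumFin (λ k → (- sign k) * M zero (suc k) * sumFin (λ i → sign i * M (suc i) zero * D i k))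
    ≡⟨ Σ-cong (λ k → *-distribˡ-Σ ((- sign k) * M zero (suc k)) (λ i → sign i * M (suc i) zero * D i k)) ⟩
      sumFin (λ k → sumFin (λ i → (- sign k) * M zero (suc k) * (sign i * M (suc i) zero * D i k)))
    ≡⟨ Σ-swap (λ k i → (- sign k) * M zero (suc k) * (sign i * M (suc i) zero * D i k)) ⟩
      sumFin (λ i → sumFin (λ k → (- sign k) * M zero (suc k) * (sign i * M (suc i) zero * D i k)))
    ≡⟨ Σ-cong (λ i → Σ-cong (λ k → reorder (sign k) (M zero (suc k)) (sign i) (M (suc i) zero) (D i k))) ⟩
      sumFin (λ i → sumFin (λ k → (- sign i) * M (suc i) zero * (sign k * M zero (suc k) * D i k)))
    ≡⟨ Σ-cong (λ i → sym (*-distribˡ-Σ ((- sign i) * M (suc i) zero) (λ k → sign k * M zero (suc k) * D i k))) ⟩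
      sumFin (λ i → (- sign i) * M (suc i) zero * det (minor M (suc i) zero))
    ∎

det-transpose : ∀ {n} (M : Matrix n) → det (M ᵀ) ≡ det M
det-transpose {ℕ.zero} M = refl
det-transpose {ℕ.suc n} M = trans
  (Σ-cong (λ j → cong (sign j * M j zero *_) (det-transpose (minor M j zero))))
  (sym (det-expand-col₀ M))

det-linear-row : ∀ {n} (i : Fin n) (α β : ℤ) (A B P : Matrix n) →
                 (∀ r c → r ≢ i → A r c ≡ P r c) → (∀ r c → r ≢ i → B r c ≡ P r c) →
                 (∀ c → P i c ≡ α * A i c + β * B i c) → det P ≡ α * det A + β * det B
det-linear-row {ℕ.suc n} i α β A B P A≡P B≡P Pᵢ = trans (Σ-cong (term i A≡P B≡P Pᵢ)) Σ-linear
  where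
  expansion : Matrix (ℕ.suc n) → Fin (ℕ.suc n) → ℤ
  expansion M j = sign j * M zero j * det (minor M zero j)
  Σ-linear : sumFin (λ j → α * expansion A j + β * expansion B j) ≡ α * det A + β * det B
  Σ-linear = trans (Σ-distrib-+ (λ j → α * expansion A j) (λ j → β * expansion B j))
    (sym (cong₂ _+_ (*-distribˡ-Σ α (expansion A)) (*-distribˡ-Σ β (expansion B))))
  term : ∀ i → (∀ r c → r ≢ i → A r c ≡ P r c) → (∀ r c → r ≢ i → B r c ≡ P r c) →
         (∀ c → P i c ≡ α * A i c + β * B i c) → ∀ j →
         sign j * P zero j * det (minor P zero j)
           ≡ α * (sign j * A zero j * det (minor A zero j)) + β * (sign j * B zero j * det (minor B zero j))
  term zero A≡P B≡P Pᵢ j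
    rewrite Pᵢ j
          | det-cong {M = minor A zero j} {N = minor P zero j} (λ r c → A≡P (suc r) (punchIn j c) λ ())
          | det-cong {M = minor B zero j} {N = minor P zero j} (λ r c → B≡P (suc r) (punchIn j c) λ ())
    = expand α β (sign j) (A zero j) (B zero j) _
    where
    expand : ∀ α β s a b d → s * (α * a + β * b) * d ≡ α * (s * a * d) + β * (s * b * d)
    expand = solve-∀
  term (suc i) A≡P B≡P Pᵢ j
    rewrite A≡P zero j (λ ()) | B≡P zero j (λ ())
          | det-linear-row i α β (minor A zero j) (minor B zero j) (minor P zero j)
              (λ r c r≢i → A≡P (suc r) (punchIn j c) (r≢i ∘ suc-injective))
              (λ r c r≢i → B≡P (suc r) (punchIn j c) (r≢i ∘ suc-injective))
              (λ c → Pᵢ (punchIn j c))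
    = expand α β (sign j) (P zero j) _ _
    where
    expand : ∀ α β s p a b → s * p * (α * a + β * b) ≡ α * (s * p * a) + β * (s * p * b)
    expand = solve-∀

det-zero-row : ∀ {n} (i : Fin n) (M : Matrix n) → (∀ c → M i c ≡ + 0) → det M ≡ + 0
det-zero-row i M Mᵢ≡0 = begin
  det M                        ≡⟨ det-linear-row i (+ 0) (+ 0) M M M (λ _ _ _ → refl) (λ _ _ _ → refl) Mᵢ≡0* ⟩
  + 0 * det M + + 0 * det M    ≡⟨ cong₂ _+_ (ℤP.*-zeroˡ (det M)) (ℤP.*-zeroˡ (det M)) ⟩
  + 0                          ∎
  where
  open ≡-Reasoning
  Mᵢ≡0* : ∀ c → M i c ≡ + 0 * M i c + + 0 * M i c
  Mᵢ≡0* c rewrite Mᵢ≡0 c = refl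

setRow : ∀ {n} → Matrix n → Fin n → (Fin n → ℤ) → Matrix n
setRow M i v r c with r ≟F i
... | yes _ = v c
... | no _ = M r c

setRow-≡ : ∀ {n} (M : Matrix n) i v c → setRow M i v i c ≡ v c
setRow-≡ M i v c with i ≟F i
... | yes _ = refl
... | no i≢i = ⊥-elim (i≢i refl)

setRow-≢ : ∀ {n} (M : Matrix n) i v {r} c → r ≢ i → setRow M i v r c ≡ M r c
setRow-≢ M i v {r} c r≢i with r ≟F i
... | yes r≡i = ⊥-elim (r≢i r≡i)
... | no _ = refl

minor-setRow-δ : ∀ {n} (M : Matrix (ℕ.suc n)) (i : Fin n) l j r c →
                 minor (setRow M (suc i) (δ (punchIn l j))) zero l r c ≡ setRow (minor M zero l) i (δ j) r c
minor-setRow-δ M i l j r c = by-cases (r ≟F i)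
  where
  by-cases : Dec (r ≡ i) → minor (setRow M (suc i) (δ (punchIn l j))) zero l r c ≡ setRow (minor M zero l) i (δ j) r c
  by-cases (yes refl) = trans (setRow-≡ M (suc r) _ (punchIn l c))
                          (trans (δ-punchIn l j c) (sym (setRow-≡ (minor M zero l) r (δ j) c)))
  by-cases (no r≢i) = trans (setRow-≢ M (suc i) _ (punchIn l c) (r≢i ∘ suc-injective))
                        (sym (setRow-≢ (minor M zero l) i (δ j) c r≢i))

det-expand-row : ∀ {n} (i : Fin n) (M : Matrix n) → det M ≡ sumFin (λ j → M i j * det (setRow M i (δ j)))
det-expand-row {ℕ.suc n} zero M = Σ-cong term
  where
  U : Fin (ℕ.suc n) → Matrix (ℕ.suc n)
  U j = setRow M zero (δ j)
  other-terms-vanish : ∀ j l → l ≢ j → sign l * U j zero l * det (minor (U j) zero l) ≡ + 0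
  other-terms-vanish j l l≢j rewrite setRow-≡ M zero (δ j) l | δ-≢ (l≢j ∘ sym) =
    trans (cong (_* det (minor (U j) zero l)) (ℤP.*-zeroʳ (sign l))) (ℤP.*-zeroˡ (det (minor (U j) zero l)))
  unit-row : ∀ j → det (U j) ≡ sign j * det (minor M zero j)
  unit-row j = trans (Σ-single _ j (other-terms-vanish j))
    (cong₂ _*_ (trans (cong (sign j *_) (trans (setRow-≡ M zero (δ j) j) (δ-refl j))) (ℤP.*-identityʳ (sign j)))
      (det-cong (λ r c → setRow-≢ M zero (δ j) (punchIn j c) λ ())))
  reorder : ∀ s a d → s * a * d ≡ a * (s * d)
  reorder = solve-∀
  term : ∀ j → sign j * M zero j * det (minor M zero j) ≡ M zero j * det (U j)
  term j rewrite unit-row j = reorder (sign j) (M zero j) (det (minor M zero j))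
det-expand-row {ℕ.suc n} (suc i) M = begin
    sumFin (λ l → sign l * M zero l * det (minor M zero l))
  ≡⟨ Σ-cong (λ l → cong (sign l * M zero l *_) (trans (det-expand-row i (minor M zero l)) (sym (inner l)))) ⟩
    sumFin (λ l → sign l * M zero l * sumFin (λ j → M (suc i) j * det (minor (U j) zero l)))
  ≡⟨ Σ-cong (λ l → *-distribˡ-Σ (sign l * M zero l) (λ j → M (suc i) j * det (minor (U j) zero l))) ⟩
    sumFin (λ l → sumFin (λ j → sign l * M zero l * (M (suc i) j * det (minor (U j) zero l))))
  ≡⟨ Σ-swap (λ l j → sign l * M zero l * (M (suc i) j * det (minor (U j) zero l))) ⟩
    sumFin (λ j → sumFin (λ l → sign l * M zero l * (M (suc i) j * det (minor (U j) zero l))))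
  ≡⟨ Σ-cong (λ j → trans (Σ-cong (λ l → reorder (sign l) (M zero l) (M (suc i) j) (det (minor (U j) zero l))))
                          (sym (*-distribˡ-Σ (M (suc i) j) (λ l → sign l * M zero l * det (minor (U j) zero l))))) ⟩
    sumFin (λ j → M (suc i) j * sumFin (λ l → sign l * M zero l * det (minor (U j) zero l)))
  ≡⟨ Σ-cong (λ j → cong (M (suc i) j *_) (Σ-cong (λ l →
       cong (λ z → sign l * z * det (minor (U j) zero l)) (sym (setRow-≢ M (suc i) (δ j) {zero} l λ ())))))⟩
    sumFin (λ j → M (suc i) j * det (U j))
  ∎
  where
  open ≡-Reasoning
  U : Fin (ℕ.suc n) → Matrix (ℕ.suc n)
  U j = setRow M (suc i) (δ j)
  reorder : ∀ s a m d → s * a * (m * d) ≡ m * (s * a * d)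
  reorder = solve-∀
  column-l-vanishes : ∀ l → det (minor (U l) zero l) ≡ + 0
  column-l-vanishes l = det-zero-row i _ (λ c →
    trans (setRow-≡ M (suc i) (δ l) (punchIn l c)) (δ-≢ (punchInᵢ≢i l c ∘ sym)))
  inner : ∀ l → sumFin (λ j → M (suc i) j * det (minor (U j) zero l))
              ≡ sumFin (λ j′ → M (suc i) (punchIn l j′) * det (setRow (minor M zero l) i (δ j′)))
  inner l = begin
      sumFin (λ j → M (suc i) j * det (minor (U j) zero l))
    ≡⟨ Σ-remove (λ j → M (suc i) j * det (minor (U j) zero l)) l ⟩
      M (suc i) l * det (minor (U l) zero l)
        + sumFin (λ j′ → M (suc i) (punchIn l j′) * det (minor (U (punchIn l j′)) zero l))
    ≡⟨ cong₂ _+_ (trans (cong (M (suc i) l *_) (column-l-vanishes l)) (ℤP.*-zeroʳ (M (suc i) l)))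
                 (Σ-cong (λ j′ → cong (M (suc i) (punchIn l j′) *_) (det-cong (minor-setRow-δ M i l j′)))) ⟩
      + 0 + sumFin (λ j′ → M (suc i) (punchIn l j′) * det (setRow (minor M zero l) i (δ j′)))
    ≡⟨ ℤP.+-identityˡ _ ⟩
      sumFin (λ j′ → M (suc i) (punchIn l j′) * det (setRow (minor M zero l) i (δ j′)))
    ∎

-- The position of k among the indices left after deleting punchIn k j.
hole : ∀ {n} → Fin (ℕ.suc (ℕ.suc n)) → Fin (ℕ.suc n) → Fin (ℕ.suc n)
hole zero j = zero
hole (suc k) zero = k
hole {ℕ.suc n} (suc k) (suc j) = suc (hole k j)

hole-punchIn : ∀ {n} (k : Fin (ℕ.suc (ℕ.suc n))) (j : Fin (ℕ.suc n)) → punchIn (punchIn k j) (hole k j) ≡ k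
hole-punchIn zero j = refl
hole-punchIn (suc k) zero = refl
hole-punchIn {ℕ.suc n} (suc k) (suc j) = cong suc (hole-punchIn k j)

punchIn-exchange : ∀ {n} (k : Fin (ℕ.suc (ℕ.suc n))) (j : Fin (ℕ.suc n)) (s : Fin n) →
                   punchIn (punchIn k j) (punchIn (hole k j) s) ≡ punchIn k (punchIn j s)
punchIn-exchange zero j s = refl
punchIn-exchange (suc k) zero s = refl
punchIn-exchange {ℕ.suc n} (suc k) (suc j) zero = refl
punchIn-exchange {ℕ.suc n} (suc k) (suc j) (suc s) = cong suc (punchIn-exchange k j s)

sign-hole : ∀ {n} (k : Fin (ℕ.suc (ℕ.suc n))) (j : Fin (ℕ.suc n)) →
            sign (punchIn k j) * sign (hole k j) ≡ - (sign k * sign j)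
sign-hole zero j = solve-∀′ (sign j)
  where
  solve-∀′ : ∀ s → - s * + 1 ≡ - (+ 1 * s)
  solve-∀′ = solve-∀
sign-hole (suc k) zero = solve-∀′ (sign k)
  where
  solve-∀′ : ∀ s → + 1 * s ≡ - (- s * + 1)
  solve-∀′ = solve-∀
sign-hole {ℕ.suc n} (suc k) (suc j) =
  trans (neg-neg (sign (punchIn k j)) (sign (hole k j))) (trans (sign-hole k j) (cong -_ (sym (neg-neg (sign k) (sign j)))))
  where
  neg-neg : ∀ a b → (- a) * (- b) ≡ a * b
  neg-neg = solve-∀

det-unit-row : ∀ {n} (i k : Fin (ℕ.suc n)) (a : ℤ) (M : Matrix (ℕ.suc n)) → (∀ j → M i j ≡ a * δ k j) →
               det M ≡ sign i * sign k * a * det (minor M i k)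
det-unit-row zero k a M Mᵢ = begin
  det M                                     ≡⟨ Σ-single _ k off-k ⟩
  sign k * M zero k * det (minor M zero k)  ≡⟨ cong (λ z → sign k * z * det (minor M zero k)) Mᵢₖ ⟩
  sign k * a * det (minor M zero k)         ≡⟨ cong (λ z → z * a * det (minor M zero k)) (sym (ℤP.*-identityˡ (sign k))) ⟩
  + 1 * sign k * a * det (minor M zero k)   ∎
  where
  open ≡-Reasoning
  Mᵢₖ : M zero k ≡ a
  Mᵢₖ = trans (Mᵢ k) (trans (cong (a *_) (δ-refl k)) (ℤP.*-identityʳ a))
  off-k : ∀ j → j ≢ k → sign j * M zero j * det (minor M zero j) ≡ + 0
  off-k j j≢k rewrite Mᵢ j | δ-≢ (j≢k ∘ sym) | ℤP.*-zeroʳ a | ℤP.*-zeroʳ (sign j) =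
    ℤP.*-zeroˡ (det (minor M zero j))
det-unit-row {ℕ.suc n} (suc i) k a M Mᵢ = begin
    sumFin (λ j → sign j * M zero j * det (minor M zero j))
  ≡⟨ Σ-remove (λ j → sign j * M zero j * det (minor M zero j)) k ⟩
    sign k * M zero k * det (minor M zero k)
      + sumFin (λ j → sign (punchIn k j) * M zero (punchIn k j) * det (minor M zero (punchIn k j)))
  ≡⟨ cong₂ _+_ (trans (cong (sign k * M zero k *_) (det-zero-row i (minor M zero k) column-k-removed))
                      (ℤP.*-zeroʳ (sign k * M zero k)))
               (Σ-cong term) ⟩
    + 0 + sumFin (λ j → (- sign i) * sign k * a * (sign j * M zero (punchIn k j) * E j))
  ≡⟨ ℤP.+-identityˡ _ ⟩
    sumFin (λ j → (- sign i) * sign k * a * (sign j * M zero (punchIn k j) * E j))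
  ≡⟨ sym (*-distribˡ-Σ ((- sign i) * sign k * a) (λ j → sign j * M zero (punchIn k j) * E j)) ⟩
    (- sign i) * sign k * a * sumFin (λ j → sign j * M zero (punchIn k j) * E j)
  ∎
  where
  open ≡-Reasoning
  E : Fin (ℕ.suc n) → ℤ
  E j = det (minor (minor M (suc i) k) zero j)
  column-k-removed : ∀ s → minor M zero k i s ≡ + 0
  column-k-removed s = trans (Mᵢ (punchIn k s)) (trans (cong (a *_) (δ-≢ (punchInᵢ≢i k s ∘ sym))) (ℤP.*-zeroʳ a))
  row-of-minor : ∀ j s → minor M zero (punchIn k j) i s ≡ a * δ (hole k j) s
  row-of-minor j s = trans (Mᵢ (punchIn (punchIn k j) s))
    (cong (a *_) (trans (cong (λ z → δ z (punchIn (punchIn k j) s)) (sym (hole-punchIn k j)))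
                        (δ-punchIn (punchIn k j) (hole k j) s)))
  regroup₁ : ∀ sj m si sq a e → sj * m * (si * sq * a * e) ≡ (sj * sq) * (m * si * a * e)
  regroup₁ = solve-∀
  regroup₂ : ∀ sk sj m si a e → (- (sk * sj)) * (m * si * a * e) ≡ (- si) * sk * a * (sj * m * e)
  regroup₂ = solve-∀
  term : ∀ j → sign (punchIn k j) * M zero (punchIn k j) * det (minor M zero (punchIn k j))
             ≡ (- sign i) * sign k * a * (sign j * M zero (punchIn k j) * E j)
  term j = begin
      sign (punchIn k j) * m * det (minor M zero (punchIn k j))
    ≡⟨ cong (sign (punchIn k j) * m *_) (det-unit-row i (hole k j) a (minor M zero (punchIn k j)) (row-of-minor j)) ⟩
      sign (punchIn k j) * m * (sign i * sign (hole k j) * a * det (minor (minor M zero (punchIn k j)) i (hole k j)))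
    ≡⟨ cong (λ z → sign (punchIn k j) * m * (sign i * sign (hole k j) * a * z))
            (det-cong (λ r s → cong (M (suc (punchIn i r))) (punchIn-exchange k j s))) ⟩
      sign (punchIn k j) * m * (sign i * sign (hole k j) * a * E j)
    ≡⟨ regroup₁ (sign (punchIn k j)) m (sign i) (sign (hole k j)) a (E j) ⟩
      (sign (punchIn k j) * sign (hole k j)) * (m * sign i * a * E j)
    ≡⟨ cong (_* (m * sign i * a * E j)) (sign-hole k j) ⟩
      (- (sign k * sign j)) * (m * sign i * a * E j)
    ≡⟨ regroup₂ (sign k) (sign j) m (sign i) a (E j) ⟩
      (- sign i) * sign k * a * (sign j * m * E j)
    ∎
    where
    m : ℤ
    m = M zero (punchIn k j)

self-negating : ∀ (x : ℤ) → x ≡ - x → x ≡ + 0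
self-negating (+ ℕ.zero) _ = refl
self-negating (+ ℕ.suc _) ()
self-negating ℤ.-[1+ _ ] ()

-- Expanding along row 1 reproduces the expansion along row 0 with every sign flipped.
det-equal-rows₀₁ : ∀ {n} (M : Matrix (ℕ.suc (ℕ.suc n))) → (∀ c → M zero c ≡ M (suc zero) c) → det M ≡ + 0
det-equal-rows₀₁ {n} M M₀≡M₁ = self-negating (det M)
  (trans (det-expand-row (suc zero) M)
    (trans (Σ-cong term) (trans (Σ-cong (λ j → sym (ℤP.-1*i≡-i (sign j * M zero j * det (minor M zero j)))))
      (trans (sym (*-distribˡ-Σ (- + 1) (λ j → sign j * M zero j * det (minor M zero j)))) (ℤP.-1*i≡-i (det M))))))
  where
  U : Fin (ℕ.suc (ℕ.suc n)) → Matrix (ℕ.suc (ℕ.suc n))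
  U j = setRow M (suc zero) (δ j)
  rows : ∀ j r s → minor (U j) (suc zero) j r s ≡ minor M zero j r s
  rows j zero s = trans (setRow-≢ M (suc zero) (δ j) (punchIn j s) (λ ())) (M₀≡M₁ (punchIn j s))
  rows j (suc r) s = setRow-≢ M (suc zero) (δ j) (punchIn j s) (λ ())
  unit-row : ∀ j c → U j (suc zero) c ≡ + 1 * δ j c
  unit-row j c = trans (setRow-≡ M (suc zero) (δ j) c) (sym (ℤP.*-identityˡ (δ j c)))
  regroup : ∀ m s d → m * ((- (+ 1)) * s * (+ 1) * d) ≡ - (s * m * d)
  regroup = solve-∀
  term : ∀ j → M (suc zero) j * det (U j) ≡ - (sign j * M zero j * det (minor M zero j))
  term j = begin
    M (suc zero) j * det (U j)
      ≡⟨ cong (M (suc zero) j *_) (det-unit-row (suc zero) j (+ 1) (U j) (unit-row j)) ⟩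
    M (suc zero) j * (- + 1 * sign j * + 1 * det (minor (U j) (suc zero) j))
      ≡⟨ cong (λ z → M (suc zero) j * (- + 1 * sign j * + 1 * z)) (det-cong (rows j)) ⟩
    M (suc zero) j * (- + 1 * sign j * + 1 * det (minor M zero j))
      ≡⟨ regroup (M (suc zero) j) (sign j) (det (minor M zero j)) ⟩
    - (sign j * M (suc zero) j * det (minor M zero j))
      ≡⟨ cong (λ z → - (sign j * z * det (minor M zero j))) (sym (M₀≡M₁ j)) ⟩
    - (sign j * M zero j * det (minor M zero j))
      ∎
    where open ≡-Reasoning

-- Expanding along row b+1 leaves a matrix whose first two rows coincide.
det-equal-rows₀ : ∀ {n} (b : Fin (ℕ.suc n)) (M : Matrix (ℕ.suc (ℕ.suc n))) →
                  (∀ c → M zero c ≡ M (suc b) c) → det M ≡ + 0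
det-equal-rows₀ {n} b M M₀≡M₁₊b = begin
    det M
  ≡⟨ det-expand-row (suc b) M ⟩
    sumFin (λ j → M (suc b) j * det (U j))
  ≡⟨ Σ-cong term ⟩
    sumFin (λ j → sign (suc b) * (sign j * Y zero j * det (minor Y zero j)))
  ≡⟨ sym (*-distribˡ-Σ (sign (suc b)) (λ j → sign j * Y zero j * det (minor Y zero j))) ⟩
    sign (suc b) * det Y
  ≡⟨ cong (sign (suc b) *_) (det-equal-rows₀₁ Y (λ c → refl)) ⟩
    sign (suc b) * + 0
  ≡⟨ ℤP.*-zeroʳ (sign (suc b)) ⟩
    + 0
  ∎
  where
  open ≡-Reasoning
  Y : Matrix (ℕ.suc (ℕ.suc n))
  Y zero c = M zero c
  Y (suc r) c = M (punchIn (suc b) r) c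
  U : Fin (ℕ.suc (ℕ.suc n)) → Matrix (ℕ.suc (ℕ.suc n))
  U j = setRow M (suc b) (δ j)
  unit-row : ∀ j c → U j (suc b) c ≡ + 1 * δ j c
  unit-row j c = trans (setRow-≡ M (suc b) (δ j) c) (sym (ℤP.*-identityˡ (δ j c)))
  regroup : ∀ m sb s d → m * (sb * s * (+ 1) * d) ≡ sb * (s * m * d)
  regroup = solve-∀
  term : ∀ j → M (suc b) j * det (U j) ≡ sign (suc b) * (sign j * Y zero j * det (minor Y zero j))
  term j = begin
    M (suc b) j * det (U j)
      ≡⟨ cong (M (suc b) j *_) (det-unit-row (suc b) j (+ 1) (U j) (unit-row j)) ⟩
    M (suc b) j * (sign (suc b) * sign j * + 1 * det (minor (U j) (suc b) j))
      ≡⟨ cong (λ z → M (suc b) j * (sign (suc b) * sign j * + 1 * z))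
              (det-cong (λ r s → setRow-≢ M (suc b) (δ j) (punchIn j s) (punchInᵢ≢i (suc b) r))) ⟩
    M (suc b) j * (sign (suc b) * sign j * + 1 * det (minor Y zero j))
      ≡⟨ regroup (M (suc b) j) (sign (suc b)) (sign j) (det (minor Y zero j)) ⟩
    sign (suc b) * (sign j * M (suc b) j * det (minor Y zero j))
      ≡⟨ cong (λ z → sign (suc b) * (sign j * z * det (minor Y zero j))) (sym (M₀≡M₁₊b j)) ⟩
    sign (suc b) * (sign j * Y zero j * det (minor Y zero j))
      ∎

det-equal-rows : ∀ {n} {a b : Fin n} → a ≢ b → (M : Matrix n) → (∀ c → M a c ≡ M b c) → det M ≡ + 0
det-equal-rows {a = zero} {zero} a≢b M _ = ⊥-elim (a≢b refl)
det-equal-rows {ℕ.suc (ℕ.suc n)} {zero} {suc b} _ M Mₐ≡M_b = det-equal-rows₀ b M Mₐ≡M_b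
det-equal-rows {ℕ.suc (ℕ.suc n)} {suc a} {zero} _ M Mₐ≡M_b = det-equal-rows₀ a M (sym ∘ Mₐ≡M_b)
det-equal-rows {ℕ.suc n} {suc a} {suc b} a≢b M Mₐ≡M_b =
  Σ-zero _ (λ j → trans (cong (sign j * M zero j *_)
                           (det-equal-rows (a≢b ∘ cong suc) (minor M zero j) (Mₐ≡M_b ∘ punchIn j)))
                        (ℤP.*-zeroʳ (sign j * M zero j)))

det-add-row : ∀ {n} {i j : Fin n} → i ≢ j → (x : ℤ) (M N : Matrix n) →
              (∀ r c → r ≢ i → N r c ≡ M r c) → (∀ c → N i c ≡ M i c + x * M j c) → det N ≡ det M
det-add-row {i = i} {j} i≢j x M N N≡M Nᵢ = begin
  det N                         ≡⟨ det-linear-row i (+ 1) x M B N (λ r c r≢i → sym (N≡M r c r≢i)) B≡N Nᵢ′ ⟩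
  + 1 * det M + x * det B       ≡⟨ cong (λ z → + 1 * det M + x * z) (det-equal-rows i≢j B Bᵢ≡Bⱼ) ⟩
  + 1 * det M + x * + 0         ≡⟨ cong₂ _+_ (ℤP.*-identityˡ (det M)) (ℤP.*-zeroʳ x) ⟩
  det M + + 0                   ≡⟨ ℤP.+-identityʳ (det M) ⟩
  det M                         ∎
  where
  open ≡-Reasoning
  B : Matrix _
  B = setRow M i (M j)
  B≡N : ∀ r c → r ≢ i → B r c ≡ N r c
  B≡N r c r≢i = trans (setRow-≢ M i (M j) c r≢i) (sym (N≡M r c r≢i))
  Nᵢ′ : ∀ c → N i c ≡ + 1 * M i c + x * B i c
  Nᵢ′ c = trans (Nᵢ c) (cong₂ _+_ (sym (ℤP.*-identityˡ (M i c))) (cong (x *_) (sym (setRow-≡ M i (M j) c))))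
  Bᵢ≡Bⱼ : ∀ c → B i c ≡ B j c
  Bᵢ≡Bⱼ c = trans (setRow-≡ M i (M j) c) (sym (setRow-≢ M i (M j) c (i≢j ∘ sym)))

det-add-col : ∀ {n} {i j : Fin n} → i ≢ j → (x : ℤ) (M N : Matrix n) →
              (∀ r c → c ≢ i → N r c ≡ M r c) → (∀ r → N r i ≡ M r i + x * M r j) → det N ≡ det M
det-add-col i≢j x M N N≡M Nᵢ = trans (sym (det-transpose N))
  (trans (det-add-row i≢j x (M ᵀ) (N ᵀ) (λ r c → N≡M c r) Nᵢ) (det-transpose M))

addColumn : ∀ {n} → Matrix n → Fin n → Fin n → Matrix n
addColumn M j i r c = M r c + δ j c * M r i

-- Subtracting row j from row i and then adding column i to column j leaves a · eᵢ as row i.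
det-merge : ∀ {n} (M : Matrix (ℕ.suc n)) {i j} (a : ℤ) → i ≢ j →
            (∀ c → M i c ≡ M j c + a * (δ i c - δ j c)) → det M ≡ a * det (minor (addColumn M j i) i i)
det-merge M {i} {j} a i≢j Mᵢ = begin
  det M
    ≡⟨ det-add-row i≢j (- + 1) M R (λ r c → setRow-≢ M i _ c) (setRow-≡ M i _) ⟨
  det R
    ≡⟨ det-add-col (i≢j ∘ sym) (+ 1) R (addColumn R j i) other-columns column-j ⟨
  det (addColumn R j i)
    ≡⟨ det-unit-row i i a (addColumn R j i) row-i ⟩
  sign i * sign i * a * det (minor (addColumn R j i) i i)
    ≡⟨ cong₂ (λ s z → s * a * z) (sign-square i) (det-cong same-minor) ⟩
  + 1 * a * det (minor (addColumn M j i) i i)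
    ≡⟨ cong (_* det (minor (addColumn M j i) i i)) (ℤP.*-identityˡ a) ⟩
  a * det (minor (addColumn M j i) i i)
    ∎
  where
  open ≡-Reasoning
  R : Matrix _
  R = setRow M i (λ c → M i c + - + 1 * M j c)
  Rᵢ : ∀ c → R i c ≡ a * (δ i c - δ j c)
  Rᵢ c rewrite setRow-≡ M i (λ c → M i c + - + 1 * M j c) c | Mᵢ c = cancel (M j c) (a * (δ i c - δ j c))
    where
    cancel : ∀ m x → m + x + - + 1 * m ≡ x
    cancel = solve-∀
  other-columns : ∀ r c → c ≢ j → addColumn R j i r c ≡ R r c
  other-columns r c c≢j rewrite δ-≢ (c≢j ∘ sym) = ℤP.+-identityʳ (R r c)
  column-j : ∀ r → addColumn R j i r j ≡ R r j + + 1 * R r i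
  column-j r rewrite δ-refl j = refl
  row-i : ∀ c → addColumn R j i i c ≡ a * δ i c
  row-i c rewrite Rᵢ c | Rᵢ i | δ-refl i | δ-≢ (i≢j ∘ sym) = cancel a (δ i c) (δ j c)
    where
    cancel : ∀ a x y → a * (x - y) + y * (a * (+ 1 - + 0)) ≡ a * x
    cancel = solve-∀
  same-minor : ∀ r s → minor (addColumn R j i) i i r s ≡ minor (addColumn M j i) i i r s
  same-minor r s = cong₂ (λ x y → x + δ j (punchIn i s) * y)
    (setRow-≢ M i _ (punchIn i s) (punchInᵢ≢i i r)) (setRow-≢ M i _ i (punchInᵢ≢i i r))

-- Formal determinants, decided by the ring solver's normal forms

open Ops using (⟦_⟧; ⟦_⇓⟧; correct)

sumᴱ : ∀ {k n} → (Fin n → Expr ℤ k) → Expr ℤ k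
sumᴱ {n = ℕ.zero} f = Κ (+ 0)
sumᴱ {n = ℕ.suc n} f = f zero ⊕ sumᴱ (f ∘ suc)

prodᴱ : ∀ {k n} → (Fin n → Expr ℤ k) → Expr ℤ k
prodᴱ {n = ℕ.zero} f = Κ (+ 1)
prodᴱ {n = ℕ.suc n} f = f zero ⊗ prodᴱ (f ∘ suc)

detᴱ : ∀ {k n} → (Fin n → Fin n → Expr ℤ k) → Expr ℤ k
detᴱ {n = ℕ.zero} A = Κ (+ 1)
detᴱ {n = ℕ.suc n} A = sumᴱ λ j → Κ (sign j) ⊗ A zero j ⊗ detᴱ (minor A zero j)

⟦sumᴱ⟧ : ∀ {k n} (f : Fin n → Expr ℤ k) ρ → ⟦ sumᴱ f ⟧ ρ ≡ sumFin (λ i → ⟦ f i ⟧ ρ)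
⟦sumᴱ⟧ {n = ℕ.zero} f ρ = refl
⟦sumᴱ⟧ {n = ℕ.suc n} f ρ = cong (_+_ (⟦ f zero ⟧ ρ)) (⟦sumᴱ⟧ (f ∘ suc) ρ)

⟦detᴱ⟧ : ∀ {k n} (A : Fin n → Fin n → Expr ℤ k) ρ → ⟦ detᴱ A ⟧ ρ ≡ det (λ i j → ⟦ A i j ⟧ ρ)
⟦detᴱ⟧ {n = ℕ.zero} A ρ = refl
⟦detᴱ⟧ {n = ℕ.suc n} A ρ = trans (⟦sumᴱ⟧ (λ j → Κ (sign j) ⊗ A zero j ⊗ detᴱ (minor A zero j)) ρ)
  (Σ-cong (λ j → cong (sign j * ⟦ A zero j ⟧ ρ *_) (⟦detᴱ⟧ (minor A zero j) ρ)))

⟦⟧-by-normal-form : ∀ {k} (x y : Expr ℤ k) ρ → ⟦ x ⇓⟧ ρ ≡ ⟦ y ⇓⟧ ρ → ⟦ x ⟧ ρ ≡ ⟦ y ⟧ ρ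
⟦⟧-by-normal-form x y ρ eq = trans (sym (correct x ρ)) (trans eq (correct y ρ))

StrictlyIncreasing : ∀ {m n} → (Fin m → Fin n) → Set
StrictlyIncreasing e = ∀ {k l} → k Fin.< l → e k Fin.< e l

module _ {m n} {e : Fin m → Fin n} (e-inc : StrictlyIncreasing e) where

  increasing⇒injective : ∀ {k l} → e k ≡ e l → k ≡ l
  increasing⇒injective {k} {l} eₖ≡eₗ with <-cmp k l
  ... | tri< k<l _ _ = ⊥-elim (<⇒≢ (e-inc k<l) eₖ≡eₗ)
  ... | tri≈ _ k≡l _ = k≡l
  ... | tri> _ _ l<k = ⊥-elim (<⇒≢ (e-inc l<k) (sym eₖ≡eₗ))

increasing-by-steps : ∀ {r n} {e : Fin (ℕ.suc r) → Fin n} → (∀ k → e (Fin.inject₁ k) Fin.< e (suc k)) →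
                      StrictlyIncreasing e
increasing-by-steps {ℕ.suc r} step {zero} {suc zero} _ = step zero
increasing-by-steps {ℕ.suc (ℕ.suc r)} {e = e} step {zero} {suc (suc l)} _ =
  ℕP.<-trans (step zero) (increasing-by-steps {e = e ∘ suc} (step ∘ suc) {zero} {suc l} ℕ.z<s)
increasing-by-steps {ℕ.suc r} {e = e} step {suc k} {suc l} (ℕ.s<s k<l) =
  increasing-by-steps {e = e ∘ suc} (step ∘ suc) k<l

increasing⇒≥ : ∀ {m n} {e : Fin m → Fin n} → StrictlyIncreasing e → ∀ k → toℕ k ℕ.≤ toℕ (e k)
increasing⇒≥ {ℕ.suc m} e-inc k = ℕP.≤-trans (ℕP.m≤m+n (toℕ k) _) (offset e-inc k)
  where
  offset : ∀ {m n} {e : Fin (ℕ.suc m) → Fin n} → StrictlyIncreasing e →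
           ∀ k → toℕ k ℕ.+ toℕ (e zero) ℕ.≤ toℕ (e k)
  offset e-inc zero = ℕP.≤-refl
  offset {ℕ.suc m} {e = e} e-inc (suc k) =
    ℕP.≤-trans (ℕP.≤-reflexive (sym (ℕP.+-suc (toℕ k) (toℕ (e zero)))))
      (ℕP.≤-trans (ℕP.+-monoʳ-≤ (toℕ k) (e-inc {zero} {suc zero} (ℕ.s≤s ℕ.z≤n)))
        (offset (λ k<l → e-inc (ℕ.s≤s k<l)) k))

module _ {m n} {e : Fin m → Fin n} (e-inc : StrictlyIncreasing e) (onto : ∀ i → ∃ λ k → e k ≡ i) where

  private
    e⁻¹ : Fin n → Fin m
    e⁻¹ i = proj₁ (onto i)

    section : ∀ i → e (e⁻¹ i) ≡ i
    section i = proj₂ (onto i)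

    e⁻¹-inc : StrictlyIncreasing e⁻¹
    e⁻¹-inc {i} {j} i<j with <-cmp (e⁻¹ i) (e⁻¹ j)
    ... | tri< lt _ _ = lt
    ... | tri≈ _ eq _ = ⊥-elim (<⇒≢ i<j (trans (sym (section i)) (trans (cong e eq) (section j))))
    ... | tri> _ _ gt = ⊥-elim (ℕP.<-asym i<j (subst₂ Fin._<_ (section j) (section i) (e-inc gt)))

    e⁻¹-injective : ∀ {i j} → e⁻¹ i ≡ e⁻¹ j → i ≡ j
    e⁻¹-injective = increasing⇒injective e⁻¹-inc

  increasing-onto⇒≡ : m ≡ n
  increasing-onto⇒≡ = cantor-schröder-bernstein (increasing⇒injective e-inc) e⁻¹-injective

  increasing-onto⇒toℕ-fixed : ∀ k → toℕ (e k) ≡ toℕ k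
  increasing-onto⇒toℕ-fixed k = ℕP.≤-antisym
    (ℕP.≤-trans (increasing⇒≥ e⁻¹-inc (e k)) (ℕP.≤-reflexive (cong toℕ (increasing⇒injective e-inc (section (e k))))))
    (increasing⇒≥ e-inc k)

punchOut-mono-< : ∀ {n} {i j k : Fin (ℕ.suc n)} (i≢j : i ≢ j) (i≢k : i ≢ k) →
                  j Fin.< k → punchOut i≢j Fin.< punchOut i≢k
punchOut-mono-< i≢j i≢k j<k =
  ≤∧≢⇒< (punchOut-mono-≤ i≢j i≢k (ℕP.<⇒≤ j<k)) (<⇒≢ j<k ∘ punchOut-injective i≢j i≢k)

overlay : ∀ {m n} → (Fin m → Fin n) → (Fin m → ℤ) → (Fin n → ℤ) → Fin n → ℤ
overlay e g f i with any? (λ k → e k ≟F i)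
... | yes (k , _) = g k
... | no _ = f i

overlay-∘ : ∀ {m n} (e : Fin m → Fin n) (φ : ℤ → ℤ) (g : Fin m → ℤ) (f : Fin n → ℤ) i →
            overlay e (φ ∘ g) (φ ∘ f) i ≡ φ (overlay e g f i)
overlay-∘ e φ g f i with any? (λ k → e k ≟F i)
... | yes _ = refl
... | no _ = refl

module _ {m n} {e : Fin m → Fin n} (e-inj : ∀ {k l} → e k ≡ e l → k ≡ l)
         (g : Fin m → ℤ) (f : Fin n → ℤ) where

  overlay-image : ∀ k → overlay e g f (e k) ≡ g k
  overlay-image k with any? (λ l → e l ≟F e k)
  ... | yes (l , eₗ≡eₖ) = cong g (e-inj eₗ≡eₖ)
  ... | no ∄ = ⊥-elim (∄ (k , refl))

  overlay-outside : ∀ {i} → (∀ k → e k ≢ i) → overlay e g f i ≡ f i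
  overlay-outside {i} i∉e with any? (λ l → e l ≟F i)
  ... | yes (l , eₗ≡i) = ⊥-elim (i∉e l eₗ≡i)
  ... | no _ = refl

module _ {m n} {e : Fin m → Fin (ℕ.suc n)} (e-inj : ∀ {k l} → e k ≡ e l → k ≡ l)
         (g : Fin m → ℤ) (f : Fin (ℕ.suc n) → ℤ) where

  overlay-punchIn : ∀ {i} (i∉e : ∀ k → e k ≢ i) x →
                    overlay e g f (punchIn i x) ≡ overlay (λ k → punchOut (i∉e k ∘ sym)) g (f ∘ punchIn i) x
  overlay-punchIn {i} i∉e x with any? (λ l → e l ≟F punchIn i x) | any? (λ l → punchOut (i∉e l ∘ sym) ≟F x)
  ... | yes (l , eₗ≡i′x) | yes (l′ , e′ₗ′≡x) =
    cong g (e-inj (trans eₗ≡i′x (trans (cong (punchIn i) (sym e′ₗ′≡x)) (punchIn-punchOut (i∉e l′ ∘ sym)))))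
  ... | yes (l , eₗ≡i′x) | no ∄ = ⊥-elim (∄ (l , trans (punchOut-cong i eₗ≡i′x) (punchOut-punchIn i)))
  ... | no ∄ | yes (l′ , e′ₗ′≡x) =
    ⊥-elim (∄ (l′ , trans (sym (punchIn-punchOut (i∉e l′ ∘ sym))) (cong (punchIn i) e′ₗ′≡x)))
  ... | no _ | no _ = refl

-- Typed matrices

module Typed {T : Set} (_≟ᵀ_ : DecidableEquality T) where

  transfer : ∀ {N} → (Fin N → ℤ) → Fin N → Fin N → Fin N → ℤ
  transfer w i j x = w x + δ j x * w i

  mass : ∀ {N} → (Fin N → T) → (Fin N → ℤ) → T → ℤ
  mass τ w c = sumFin (λ x → 𝟙 (τ x ≟ᵀ c) * w x)

  mass-merge : ∀ {N} (τ : Fin (ℕ.suc N) → T) (w : Fin (ℕ.suc N) → ℤ) {i j} → i ≢ j → τ i ≡ τ j →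
               ∀ c → mass (τ ∘ punchIn i) (transfer w i j ∘ punchIn i) c ≡ mass τ w c
  mass-merge τ w {i} {j} i≢j τi≡τj c = +-cancelˡ (𝟙 (τ i ≟ᵀ c) * w i) _ _ (begin
      𝟙 (τ i ≟ᵀ c) * w i + mass (τ ∘ punchIn i) (transfer w i j ∘ punchIn i) c
    ≡⟨ cong (λ z → 𝟙 (τ i ≟ᵀ c) * z + mass (τ ∘ punchIn i) (transfer w i j ∘ punchIn i) c) transferᵢ ⟨
      𝟙 (τ i ≟ᵀ c) * transfer w i j i + mass (τ ∘ punchIn i) (transfer w i j ∘ punchIn i) c
    ≡⟨ Σ-remove (λ x → 𝟙 (τ x ≟ᵀ c) * transfer w i j x) i ⟨
      mass τ (transfer w i j) c
    ≡⟨ Σ-cong (λ x → ℤP.*-distribˡ-+ (𝟙 (τ x ≟ᵀ c)) (w x) (δ j x * w i)) ⟩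
      sumFin (λ x → 𝟙 (τ x ≟ᵀ c) * w x + 𝟙 (τ x ≟ᵀ c) * (δ j x * w i))
    ≡⟨ Σ-distrib-+ (λ x → 𝟙 (τ x ≟ᵀ c) * w x) (λ x → 𝟙 (τ x ≟ᵀ c) * (δ j x * w i)) ⟩
      mass τ w c + sumFin (λ x → 𝟙 (τ x ≟ᵀ c) * (δ j x * w i))
    ≡⟨ cong (_+_ (mass τ w c)) at-j ⟩
      mass τ w c + 𝟙 (τ j ≟ᵀ c) * (+ 1 * w i)
    ≡⟨ cong₂ (λ a b → mass τ w c + 𝟙 (a ≟ᵀ c) * b) (sym τi≡τj) (ℤP.*-identityˡ (w i)) ⟩
      mass τ w c + 𝟙 (τ i ≟ᵀ c) * w i
    ≡⟨ ℤP.+-comm (mass τ w c) _ ⟩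
      𝟙 (τ i ≟ᵀ c) * w i + mass τ w c
    ∎)
    where
    open ≡-Reasoning
    transferᵢ : transfer w i j i ≡ w i
    transferᵢ = trans (cong (λ z → w i + z * w i) (δ-≢ (i≢j ∘ sym))) (ℤP.+-identityʳ (w i))
    off-j : ∀ x → x ≢ j → 𝟙 (τ x ≟ᵀ c) * (δ j x * w i) ≡ + 0
    off-j x x≢j rewrite δ-≢ (x≢j ∘ sym) = ℤP.*-zeroʳ (𝟙 (τ x ≟ᵀ c))
    at-j : sumFin (λ x → 𝟙 (τ x ≟ᵀ c) * (δ j x * w i)) ≡ 𝟙 (τ j ≟ᵀ c) * (+ 1 * w i)
    at-j = trans (Σ-single _ j off-j) (cong (λ z → 𝟙 (τ j ≟ᵀ c) * (z * w i)) (δ-refl j))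

  Σ-by-type : ∀ {m N} (τ : Fin N → T) (w : Fin N → ℤ) (e : Fin m → Fin N) →
              (∀ {k l} → τ (e k) ≡ τ (e l) → k ≡ l) → (∀ x → ∃ λ k → τ x ≡ τ (e k)) →
              (f : T → ℤ) → sumFin (λ x → f (τ x) * w x) ≡ sumFin (λ k → f (τ (e k)) * mass τ w (τ (e k)))
  Σ-by-type τ w e τe-inj covers f = sym (begin
      sumFin (λ k → f (τ (e k)) * mass τ w (τ (e k)))
    ≡⟨ Σ-cong (λ k → *-distribˡ-Σ (f (τ (e k))) (λ x → 𝟙 (τ x ≟ᵀ τ (e k)) * w x)) ⟩
      sumFin (λ k → sumFin (λ x → f (τ (e k)) * (𝟙 (τ x ≟ᵀ τ (e k)) * w x)))
    ≡⟨ Σ-swap (λ k x → f (τ (e k)) * (𝟙 (τ x ≟ᵀ τ (e k)) * w x)) ⟩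
      sumFin (λ x → sumFin (λ k → f (τ (e k)) * (𝟙 (τ x ≟ᵀ τ (e k)) * w x)))
    ≡⟨ Σ-cong (λ x → trans (Σ-single _ (proj₁ (covers x)) (other-types x)) (own-type x)) ⟩
      sumFin (λ x → f (τ x) * w x)
    ∎)
    where
    open ≡-Reasoning
    other-types : ∀ x k → k ≢ proj₁ (covers x) → f (τ (e k)) * (𝟙 (τ x ≟ᵀ τ (e k)) * w x) ≡ + 0
    other-types x k k≢kₓ with τ x ≟ᵀ τ (e k)
    ... | yes τx≡τeₖ = ⊥-elim (k≢kₓ (τe-inj (trans (sym τx≡τeₖ) (proj₂ (covers x)))))
    ... | no _ = ℤP.*-zeroʳ (f (τ (e k)))
    own-type : ∀ x → let k = proj₁ (covers x) in f (τ (e k)) * (𝟙 (τ x ≟ᵀ τ (e k)) * w x) ≡ f (τ x) * w x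
    own-type x with covers x
    ... | k , τx≡τeₖ with τ x ≟ᵀ τ (e k)
    ...   | yes _ = cong₂ _*_ (cong f (sym τx≡τeₖ)) (ℤP.*-identityˡ (w x))
    ...   | no τx≢τeₖ = ⊥-elim (τx≢τeₖ τx≡τeₖ)

  module _ (d : T → ℤ) (K : T → T → ℤ) where

    typed : ∀ {N} → (Fin N → T) → (Fin N → ℤ) → Matrix N
    typed τ w i j = d (τ i) * δ i j + K (τ i) (τ j) * w j

    det-typed-merge : ∀ {N} (τ : Fin (ℕ.suc N) → T) (w : Fin (ℕ.suc N) → ℤ) {i j} → i ≢ j → τ i ≡ τ j →
                      det (typed τ w) ≡ d (τ i) * det (typed (τ ∘ punchIn i) (transfer w i j ∘ punchIn i))
    det-typed-merge {N} τ w {i} {j} i≢j τi≡τj =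
      trans (det-merge (typed τ w) (d (τ i)) i≢j row-i) (cong (d (τ i) *_) (det-cong merged))
      where
      row-i : ∀ c → typed τ w i c ≡ typed τ w j c + d (τ i) * (δ i c - δ j c)
      row-i c rewrite τi≡τj = split (d (τ j)) (δ i c) (δ j c) (K (τ j) (τ c) * w c)
        where
        split : ∀ a x y k → a * x + k ≡ a * y + k + a * (x - y)
        split = solve-∀
      merged : ∀ r s → minor (addColumn (typed τ w) j i) i i r s
                     ≡ typed (τ ∘ punchIn i) (transfer w i j ∘ punchIn i) r s
      merged r s = begin
          a * δ r′ s′ + k s′ * w s′ + δ j s′ * (a * δ r′ i + k i * w i)
        ≡⟨ cong₂ (λ x y → a * x + k s′ * w s′ + δ j s′ * (a * y + k i * w i))
                 (δ-punchIn i r s) (δ-≢ (punchInᵢ≢i i r)) ⟩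
          a * δ r s + k s′ * w s′ + δ j s′ * (a * + 0 + k i * w i)
        ≡⟨ regroup a (δ r s) (k s′) (w s′) (δ j s′) (k i) (w i) ⟩
          a * δ r s + k s′ * w s′ + k i * δ j s′ * w i
        ≡⟨ cong (λ z → a * δ r s + k s′ * w s′ + z * w i)
                (trans (cong (λ c → K (τ r′) c * δ j s′) τi≡τj) (δ-diagonal k j s′)) ⟩
          a * δ r s + k s′ * w s′ + k s′ * δ j s′ * w i
        ≡⟨ ungroup a (δ r s) (k s′) (w s′) (δ j s′) (w i) ⟩
          a * δ r s + k s′ * (w s′ + δ j s′ * w i)
        ∎
        where
        open ≡-Reasoning
        r′ s′ : Fin (ℕ.suc N)
        r′ = punchIn i r
        s′ = punchIn i s
        a : ℤ
        a = d (τ r′)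
        k : Fin (ℕ.suc N) → ℤ
        k c = K (τ r′) (τ c)
        regroup : ∀ a x kₛ wₛ δⱼ kᵢ wᵢ →
                  a * x + kₛ * wₛ + δⱼ * (a * + 0 + kᵢ * wᵢ) ≡ a * x + kₛ * wₛ + kᵢ * δⱼ * wᵢ
        regroup = solve-∀
        ungroup : ∀ a x kₛ wₛ δⱼ wᵢ → a * x + kₛ * wₛ + kₛ * δⱼ * wᵢ ≡ a * x + kₛ * (wₛ + δⱼ * wᵢ)
        ungroup = solve-∀

    all-representatives :
      ∀ {m N} (τ : Fin N → T) (w : Fin N → ℤ) (e : Fin m → Fin N) → StrictlyIncreasing e →
      (∀ {k l} → τ (e k) ≡ τ (e l) → k ≡ l) →
      (g : Fin m → ℤ) → det (typed (τ ∘ e) (mass τ w ∘ τ ∘ e)) ≡ prodFin g →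
      (∀ x → ∃ λ k → e k ≡ x) → det (typed τ w) ≡ prodFin (overlay e g (d ∘ τ))
    all-representatives τ w e e-inc τe-inj g small onto with increasing-onto⇒≡ e-inc onto
    ... | refl = begin
      det (typed τ w)                          ≡⟨ det-cong entries ⟩
      det (typed (τ ∘ e) (mass τ w ∘ τ ∘ e))   ≡⟨ small ⟩
      prodFin g                                ≡⟨ Π-cong (λ k → trans (sym (overlay-image e-inj g (d ∘ τ) k))
                                                                        (cong (overlay e g (d ∘ τ)) (e≡id k))) ⟩
      prodFin (overlay e g (d ∘ τ))            ∎
      where
      open ≡-Reasoning
      e-inj : ∀ {k l} → e k ≡ e l → k ≡ l
      e-inj = increasing⇒injective e-inc
      e≡id : ∀ k → e k ≡ k
      e≡id k = toℕ-injective (increasing-onto⇒toℕ-fixed e-inc onto k)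
      τ-inj : ∀ {x y} → τ x ≡ τ y → x ≡ y
      τ-inj {x} {y} eq = τe-inj (subst₂ (λ a b → τ a ≡ τ b) (sym (e≡id x)) (sym (e≡id y)) eq)
      mass-single : ∀ y → mass τ w (τ y) ≡ w y
      mass-single y = trans (Σ-single _ y off-y) on-y
        where
        off-y : ∀ x → x ≢ y → 𝟙 (τ x ≟ᵀ τ y) * w x ≡ + 0
        off-y x x≢y with τ x ≟ᵀ τ y
        ... | yes τx≡τy = ⊥-elim (x≢y (τ-inj τx≡τy))
        ... | no _ = refl
        on-y : 𝟙 (τ y ≟ᵀ τ y) * w y ≡ w y
        on-y with τ y ≟ᵀ τ y
        ... | yes _ = ℤP.*-identityˡ (w y)
        ... | no τy≢τy = ⊥-elim (τy≢τy refl)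
      entries : ∀ x y → typed τ w x y ≡ typed (τ ∘ e) (mass τ w ∘ τ ∘ e) x y
      entries x y rewrite e≡id x | e≡id y | mass-single y = refl

    -- e lists one vertex of each type, in increasing order so that no merge permutes the survivors.
    det-typed-compress :
      ∀ {m N} (τ : Fin N → T) (w : Fin N → ℤ) (e : Fin m → Fin N) → StrictlyIncreasing e →
      (∀ {k l} → τ (e k) ≡ τ (e l) → k ≡ l) → (∀ x → ∃ λ k → τ x ≡ τ (e k)) →
      (g : Fin m → ℤ) → det (typed (τ ∘ e) (mass τ w ∘ τ ∘ e)) ≡ prodFin g →
      det (typed τ w) ≡ prodFin (overlay e g (d ∘ τ))
    det-typed-compress {N = ℕ.zero} τ w e e-inc τe-inj covers g small =
      all-representatives τ w e e-inc τe-inj g small (λ ())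
    det-typed-compress {N = ℕ.suc N} τ w e e-inc τe-inj covers g small
      with any? (λ i → ¬? (any? (λ k → e k ≟F i)))
    ... | no ∄ = all-representatives τ w e e-inc τe-inj g small
                   (λ i → decidable-stable (any? (λ k → e k ≟F i)) (λ i∉ → ∄ (i , i∉)))
    ... | yes (i , i∉) = begin
        det (typed τ w)
          ≡⟨ det-typed-merge τ w i≢j τi≡τj ⟩
        d (τ i) * det (typed τ′ w′)
          ≡⟨ cong (d (τ i) *_) (det-typed-compress τ′ w′ e′ e′-inc τ′e′-inj covers′ g small′) ⟩
        d (τ i) * prodFin (overlay e′ g (d ∘ τ′))
          ≡⟨ cong₂ _*_ (sym (overlay-outside e-inj g (d ∘ τ) i∉e))
                       (Π-cong (λ x → sym (overlay-punchIn e-inj g (d ∘ τ) i∉e x))) ⟩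
        overlay e g (d ∘ τ) i * prodFin (overlay e g (d ∘ τ) ∘ punchIn i)
          ≡⟨ Π-remove (overlay e g (d ∘ τ)) i ⟨
        prodFin (overlay e g (d ∘ τ))
          ∎
      where
      open ≡-Reasoning
      e-inj : ∀ {k l} → e k ≡ e l → k ≡ l
      e-inj = increasing⇒injective e-inc
      i∉e : ∀ k → e k ≢ i
      i∉e k eₖ≡i = i∉ (k , eₖ≡i)
      j : Fin (ℕ.suc N)
      j = e (proj₁ (covers i))
      τi≡τj : τ i ≡ τ j
      τi≡τj = proj₂ (covers i)
      i≢j : i ≢ j
      i≢j i≡j = i∉e (proj₁ (covers i)) (sym i≡j)
      τ′ : Fin N → T
      τ′ = τ ∘ punchIn i
      w′ : Fin N → ℤ
      w′ = transfer w i j ∘ punchIn i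
      e′ : Fin _ → Fin N
      e′ l = punchOut (i∉e l ∘ sym)
      punchIn-e′ : ∀ l → punchIn i (e′ l) ≡ e l
      punchIn-e′ l = punchIn-punchOut (i∉e l ∘ sym)
      τ′e′≡τe : ∀ l → τ′ (e′ l) ≡ τ (e l)
      τ′e′≡τe l = cong τ (punchIn-e′ l)
      e′-inc : StrictlyIncreasing e′
      e′-inc k<l = punchOut-mono-< (i∉e _ ∘ sym) (i∉e _ ∘ sym) (e-inc k<l)
      τ′e′-inj : ∀ {k l} → τ′ (e′ k) ≡ τ′ (e′ l) → k ≡ l
      τ′e′-inj {k} {l} eq = τe-inj (trans (sym (τ′e′≡τe k)) (trans eq (τ′e′≡τe l)))
      covers′ : ∀ x → ∃ λ l → τ′ x ≡ τ′ (e′ l)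
      covers′ x = proj₁ (covers (punchIn i x)) , trans (proj₂ (covers (punchIn i x))) (sym (τ′e′≡τe _))
      small′ : det (typed (τ′ ∘ e′) (mass τ′ w′ ∘ τ′ ∘ e′)) ≡ prodFin g
      small′ = trans (det-cong entries) small
        where
        entries : ∀ r s → typed (τ′ ∘ e′) (mass τ′ w′ ∘ τ′ ∘ e′) r s
                        ≡ typed (τ ∘ e) (mass τ w ∘ τ ∘ e) r s
        entries r s rewrite τ′e′≡τe r | τ′e′≡τe s | mass-merge τ w i≢j τi≡τj (τ (e s)) = refl

  module _ (K : T → T → ℤ) {m} (reps : Fin m → T) where

    quotient : ℤ → (Fin m → ℤ) → Matrix m
    quotient t W = typed (λ κ → t - sumFin (λ l → K κ (reps l) * W l)) K reps W

    quotientᴱ : Fin m → Fin m → Expr ℤ (ℕ.suc m)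
    quotientᴱ r s = (dᴱ (reps r) ⊗ Κ (δ r s)) ⊕ (Κ (K (reps r) (reps s)) ⊗ Ι (suc s))
      where
      dᴱ : T → Expr ℤ (ℕ.suc m)
      dᴱ κ = Ι zero ⊕ (⊝ sumᴱ (λ l → Κ (K κ (reps l)) ⊗ Ι (suc l)))

    det-quotient : ∀ t W → det (quotient t W) ≡ ⟦ detᴱ quotientᴱ ⟧ (t ∷ tabulate W)
    det-quotient t W = sym (trans (⟦detᴱ⟧ quotientᴱ ρ) (det-cong entries))
      where
      ρ : Vec ℤ (ℕ.suc m)
      ρ = t ∷ tabulate W
      entries : ∀ r s → ⟦ quotientᴱ r s ⟧ ρ ≡ quotient t W r s
      entries r s = cong₂ (λ x y → (t - x) * δ r s + K (reps r) (reps s) * y)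
        (trans (⟦sumᴱ⟧ (λ l → Κ (K (reps r) (reps l)) ⊗ Ι (suc l)) ρ)
               (Σ-cong (λ l → cong (K (reps r) (reps l) *_) (lookup∘tabulate W l))))
        (lookup∘tabulate W s)


-- Comaximality in ℤ_n

module _ {m : ℕ} where

  private
    n : ℕ
    n = ℕ.suc m

  comaximal⇒coprime : 1 ℕ.< n → ∀ {x y} → Comaximal n x y →
                      ∀ {h} → h ∣ n → h ∣ toℕ x → h ∣ toℕ y → h ∣ 1
  comaximal⇒coprime 1<n {x} {y} (a , b , ax+by≡1) {h} h∣n h∣x h∣y =
    subst (h ∣_) (trans ax+by≡1 (m<n⇒m%n≡m 1<n)) h∣ax+by%n
    where
    s : ℕ
    s = toℕ a ℕ.* toℕ x ℕ.+ toℕ b ℕ.* toℕ y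
    h∣ax+by : h ∣ s
    h∣ax+by = ∣m∣n⇒∣m+n (∣n⇒∣m*n (toℕ a) h∣x) (∣n⇒∣m*n (toℕ b) h∣y)
    h∣ax+by%n : h ∣ s % n
    h∣ax+by%n = ∣m+n∣m⇒∣n (subst (h ∣_) (trans (m≡m%n+[m/n]*n s n) (ℕP.+-comm (s % n) _)) h∣ax+by)
                          (∣n⇒∣m*n (s / n) h∣n)

  -- A Bézout identity d = a·u - b·v becomes a·u + (n-1)·b·v ≡ d (mod n).
  bézout-mod : ∀ {d u v} → Bézout.Identity d u v → ∃₂ λ a b → (a ℕ.* u ℕ.+ b ℕ.* v) % n ≡ d % n
  bézout-mod {d} {u} {v} (Bézout.+- A B d+Bv≡Au) =
    A , m ℕ.* B , trans (cong (_% n) (trans (cong (ℕ._+ m ℕ.* B ℕ.* v) (sym d+Bv≡Au)) (regroup d B v m)))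
                        ([m+kn]%n≡m%n d (B ℕ.* v) n)
    where
    regroup : ∀ d B v m → d ℕ.+ B ℕ.* v ℕ.+ m ℕ.* B ℕ.* v ≡ d ℕ.+ B ℕ.* v ℕ.* ℕ.suc m
    regroup = ℕ-Solver.solve-∀
  bézout-mod {d} {u} {v} (Bézout.-+ A B d+Au≡Bv) =
    m ℕ.* A , B , trans (cong (_% n) (trans (cong (m ℕ.* A ℕ.* u ℕ.+_) (sym d+Au≡Bv)) (regroup d A u m)))
                        ([m+kn]%n≡m%n d (A ℕ.* u) n)
    where
    regroup : ∀ d A u m → m ℕ.* A ℕ.* u ℕ.+ (d ℕ.+ A ℕ.* u) ≡ d ℕ.+ A ℕ.* u ℕ.* ℕ.suc m
    regroup = ℕ-Solver.solve-∀

  %-reduce-coefficients : ∀ a b u v → ((a % n) ℕ.* u ℕ.+ (b % n) ℕ.* v) % n ≡ (a ℕ.* u ℕ.+ b ℕ.* v) % n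
  %-reduce-coefficients a b u v = trans
    (sym ([m+kn]%n≡m%n ((a % n) ℕ.* u ℕ.+ (b % n) ℕ.* v) ((a / n) ℕ.* u ℕ.+ (b / n) ℕ.* v) n))
    (cong (_% n) (trans (regroup (a % n) (a / n) (b % n) (b / n) u v n)
      (sym (cong₂ (λ a′ b′ → a′ ℕ.* u ℕ.+ b′ ℕ.* v) (m≡m%n+[m/n]*n a n) (m≡m%n+[m/n]*n b n)))))
    where
    regroup : ∀ ar aq br bq u v n → ar ℕ.* u ℕ.+ br ℕ.* v ℕ.+ (aq ℕ.* u ℕ.+ bq ℕ.* v) ℕ.* n
                                   ≡ (ar ℕ.+ aq ℕ.* n) ℕ.* u ℕ.+ (br ℕ.+ bq ℕ.* n) ℕ.* v
    regroup = ℕ-Solver.solve-∀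

  %-*-congˡ : ∀ c {X Y} → X % n ≡ Y % n → (c ℕ.* X) % n ≡ (c ℕ.* Y) % n
  %-*-congˡ c {X} {Y} X≡Y = trans (%-distribˡ-* c X n)
    (trans (cong (λ z → ((c % n) ℕ.* z) % n) X≡Y) (sym (%-distribˡ-* c Y n)))

  gcd-coprime : ∀ (x y : Fin n) → (∀ {h} → h ∣ n → h ∣ toℕ x → h ∣ toℕ y → h ≡ 1) →
                Coprime (gcd (toℕ x) (toℕ y)) n
  gcd-coprime x y coprime (h∣g , h∣n) =
    coprime h∣n (∣-trans h∣g (gcd[m,n]∣m (toℕ x) (toℕ y))) (∣-trans h∣g (gcd[m,n]∣n (toℕ x) (toℕ y)))

  coprime⇒comaximal : ∀ x y → (∀ {h} → h ∣ n → h ∣ toℕ x → h ∣ toℕ y → h ≡ 1) → Comaximal n x y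
  coprime⇒comaximal x y coprime
    with bézout-mod (Bézout.identity (gcd-GCD (toℕ x) (toℕ y)))
       | bézout-mod (coprime-Bézout (gcd-coprime x y coprime))
  ... | a , b , ax+by≡g | c , c′ , cg+c′n≡1 =
    fromℕ< (m%n<n (c ℕ.* a) n) , fromℕ< (m%n<n (c ℕ.* b) n) , (begin
      (toℕ (fromℕ< (m%n<n (c ℕ.* a) n)) ℕ.* toℕ x ℕ.+ toℕ (fromℕ< (m%n<n (c ℕ.* b) n)) ℕ.* toℕ y) % n
        ≡⟨ cong₂ (λ a′ b′ → (a′ ℕ.* toℕ x ℕ.+ b′ ℕ.* toℕ y) % n)
                 (toℕ-fromℕ< (m%n<n (c ℕ.* a) n)) (toℕ-fromℕ< (m%n<n (c ℕ.* b) n)) ⟩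
      ((c ℕ.* a) % n ℕ.* toℕ x ℕ.+ (c ℕ.* b) % n ℕ.* toℕ y) % n
        ≡⟨ %-reduce-coefficients (c ℕ.* a) (c ℕ.* b) (toℕ x) (toℕ y) ⟩
      (c ℕ.* a ℕ.* toℕ x ℕ.+ c ℕ.* b ℕ.* toℕ y) % n
        ≡⟨ cong (_% n) (regroup c a b (toℕ x) (toℕ y)) ⟩
      (c ℕ.* (a ℕ.* toℕ x ℕ.+ b ℕ.* toℕ y)) % n
        ≡⟨ %-*-congˡ c ax+by≡g ⟩
      (c ℕ.* g) % n
        ≡⟨ [m+kn]%n≡m%n (c ℕ.* g) c′ n ⟨
      (c ℕ.* g ℕ.+ c′ ℕ.* n) % n
        ≡⟨ cg+c′n≡1 ⟩
      1 % n
        ∎)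
    where
    open ≡-Reasoning
    g : ℕ
    g = gcd (toℕ x) (toℕ y)
    regroup : ∀ c a b x y → c ℕ.* a ℕ.* x ℕ.+ c ℕ.* b ℕ.* y ≡ c ℕ.* (a ℕ.* x ℕ.+ b ℕ.* y)
    regroup = ℕ-Solver.solve-∀

coprime-to-prime : ∀ {p h} → Prime p → ¬ p ∣ h → Coprime h p
coprime-to-prime p-prime p∤h (d∣h , d∣p) with prime⇒irreducible p-prime d∣p
... | inj₁ d≡1 = d≡1
... | inj₂ refl = ⊥-elim (p∤h d∣h)

divisor-of-prime-powers : ∀ {p q} → Prime p → Prime q → ∀ α β {h} →
                          h ∣ p ^ α ℕ.* q ^ β → ¬ p ∣ h → ¬ q ∣ h → h ≡ 1
divisor-of-prime-powers {p} {q} p-prime q-prime (ℕ.suc α) β {h} h∣n p∤h q∤h =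
  divisor-of-prime-powers p-prime q-prime α β
    (coprime-divisor (coprime-to-prime p-prime p∤h) (subst (h ∣_) (ℕP.*-assoc p (p ^ α) (q ^ β)) h∣n)) p∤h q∤h
divisor-of-prime-powers {p} {q} p-prime q-prime ℕ.zero (ℕ.suc β) {h} h∣n p∤h q∤h =
  divisor-of-prime-powers p-prime q-prime ℕ.zero β
    (subst (h ∣_) (sym (ℕP.*-identityˡ (q ^ β)))
      (coprime-divisor (coprime-to-prime q-prime q∤h) (subst (h ∣_) (ℕP.*-identityˡ (q ^ ℕ.suc β)) h∣n)))
    p∤h q∤h
divisor-of-prime-powers p-prime q-prime ℕ.zero ℕ.zero h∣1 _ _ = ∣1⇒≡1 h∣1

record PrimeSupport (n : ℕ) : Set where
  field
    P Q : ℕ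
    P-prime : Prime P
    Q-prime : Prime Q
    P∣n : P ∣ n
    Q∣n : Q ∣ n
    P≤Q : P ℕ.≤ Q
    only-P-Q : ∀ {h} → h ∣ n → ¬ P ∣ h → ¬ Q ∣ h → h ≡ 1

∣pᵅ⁺¹q : ∀ p α q → p ∣ p ^ ℕ.suc α ℕ.* q
∣pᵅ⁺¹q p α q = ∣m⇒∣m*n q (m∣m*n (p ^ α))

∣pqᵝ⁺¹ : ∀ p q β → q ∣ p ℕ.* q ^ ℕ.suc β
∣pqᵝ⁺¹ p q β = ∣n⇒∣m*n p (m∣m*n (q ^ β))

prime-support : ∀ {n p q} α β → 1 ℕ.< n → Prime p → Prime q → n ≡ p ^ α ℕ.* q ^ β → PrimeSupport n
prime-support ℕ.zero ℕ.zero 1<n _ _ refl = ⊥-elim (ℕP.<-irrefl refl 1<n)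
prime-support {p = p} {q} ℕ.zero (ℕ.suc β) _ _ q-prime refl = record
  { P = q ; Q = q ; P-prime = q-prime ; Q-prime = q-prime
  ; P∣n = ∣pqᵝ⁺¹ 1 q β ; Q∣n = ∣pqᵝ⁺¹ 1 q β ; P≤Q = ℕP.≤-refl
  ; only-P-Q = λ h∣n q∤h _ → divisor-of-prime-powers q-prime q-prime ℕ.zero (ℕ.suc β) h∣n q∤h q∤h }
prime-support {p = p} {q} (ℕ.suc α) ℕ.zero _ p-prime _ refl = record
  { P = p ; Q = p ; P-prime = p-prime ; Q-prime = p-prime
  ; P∣n = ∣pᵅ⁺¹q p α 1 ; Q∣n = ∣pᵅ⁺¹q p α 1 ; P≤Q = ℕP.≤-refl
  ; only-P-Q = λ h∣n p∤h _ → divisor-of-prime-powers p-prime p-prime (ℕ.suc α) ℕ.zero h∣n p∤h p∤h }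
prime-support {p = p} {q} (ℕ.suc α) (ℕ.suc β) _ p-prime q-prime refl with ℕP.≤-total p q
... | inj₁ p≤q = record
  { P = p ; Q = q ; P-prime = p-prime ; Q-prime = q-prime
  ; P∣n = ∣pᵅ⁺¹q p α (q ^ ℕ.suc β) ; Q∣n = ∣pqᵝ⁺¹ (p ^ ℕ.suc α) q β ; P≤Q = p≤q
  ; only-P-Q = λ h∣n p∤h q∤h → divisor-of-prime-powers p-prime q-prime (ℕ.suc α) (ℕ.suc β) h∣n p∤h q∤h }
... | inj₂ q≤p = record
  { P = q ; Q = p ; P-prime = q-prime ; Q-prime = p-prime
  ; P∣n = ∣pqᵝ⁺¹ (p ^ ℕ.suc α) q β ; Q∣n = ∣pᵅ⁺¹q p α (q ^ ℕ.suc β) ; P≤Q = q≤p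
  ; only-P-Q = λ h∣n q∤h p∤h → divisor-of-prime-powers p-prime q-prime (ℕ.suc α) (ℕ.suc β) h∣n p∤h q∤h }

-- Kinds of residues

Kind : Set
Kind = Bool × Bool

_≟ᴷ_ : DecidableEquality Kind
_≟ᴷ_ = ≡-dec Bool._≟_ Bool._≟_

kernel : Kind → Kind → ℤ
kernel (a , b) (a′ , b′) = if not (a ∧ a′) ∧ not (b ∧ b′) then + 1 else + 0

both unit only-P only-Q : Kind
both = true , true
unit = false , false
only-P = true , false
only-Q = false , true

open Typed _≟ᴷ_

pattern 0F = zero
pattern 1F = suc zero
pattern 2F = suc (suc zero)
pattern 3F = suc (suc (suc zero))

kinds₂ : Fin 2 → Kind
kinds₂ 0F = both
kinds₂ 1F = unit

kinds₄ : Fin 4 → Kind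
kinds₄ 0F = both
kinds₄ 1F = unit
kinds₄ 2F = only-P
kinds₄ 3F = only-Q

kinds₂-injective : ∀ {k l} → kinds₂ k ≡ kinds₂ l → k ≡ l
kinds₂-injective {k} {l} eq = trans (sym (index-kinds k)) (trans (cong index eq) (index-kinds l))
  where
  index : Kind → Fin 2
  index (a , _) = if a then 0F else 1F
  index-kinds : ∀ k → index (kinds₂ k) ≡ k
  index-kinds 0F = refl
  index-kinds 1F = refl

index₄ : Kind → Fin 4
index₄ (true , true) = 0F
index₄ (false , false) = 1F
index₄ (true , false) = 2F
index₄ (false , true) = 3F

kinds₄-index₄ : ∀ κ → kinds₄ (index₄ κ) ≡ κ
kinds₄-index₄ (true , true) = refl
kinds₄-index₄ (false , false) = refl
kinds₄-index₄ (true , false) = refl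
kinds₄-index₄ (false , true) = refl

kinds₄-injective : ∀ {k l} → kinds₄ k ≡ kinds₄ l → k ≡ l
kinds₄-injective {k} {l} eq = trans (sym (index-kinds k)) (trans (cong index₄ eq) (index-kinds l))
  where
  index-kinds : ∀ k → index₄ (kinds₄ k) ≡ k
  index-kinds 0F = refl
  index-kinds 1F = refl
  index-kinds 2F = refl
  index-kinds 3F = refl

spectrum₂ : (Fin 2 → ℤ) → Fin 2 → ℤ
spectrum₂ W 0F = + 0
spectrum₂ W 1F = W 0F + W 1F

spectrum₄ : (Fin 4 → ℤ) → Fin 4 → ℤ
spectrum₄ W 0F = + 0
spectrum₄ W 1F = W 0F + W 1F + W 2F + W 3F
spectrum₄ W 2F = W 1F + W 2F + W 3F
spectrum₄ W 3F = W 1F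

det-quotient₂ : ∀ t W → det (quotient kernel kinds₂ t W) ≡ prodFin (λ k → t - spectrum₂ W k)
det-quotient₂ t W = trans (det-quotient kernel kinds₂ t W)
  (⟦⟧-by-normal-form (detᴱ (quotientᴱ kernel kinds₂)) (prodᴱ (λ k → Ι zero ⊕ (⊝ spectrumᴱ k))) ρ refl)
  where
  ρ : Vec ℤ 3
  ρ = t ∷ tabulate W
  spectrumᴱ : Fin 2 → Expr ℤ 3
  spectrumᴱ 0F = Κ (+ 0)
  spectrumᴱ 1F = Ι 1F ⊕ Ι 2F

det-quotient₄ : ∀ t W → det (quotient kernel kinds₄ t W) ≡ prodFin (λ k → t - spectrum₄ W k)
det-quotient₄ t W = trans (det-quotient kernel kinds₄ t W)
  (⟦⟧-by-normal-form (detᴱ (quotientᴱ kernel kinds₄)) (prodᴱ (λ k → Ι zero ⊕ (⊝ spectrumᴱ k))) ρ refl)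
  where
  ρ : Vec ℤ 5
  ρ = t ∷ tabulate W
  spectrumᴱ : Fin 4 → Expr ℤ 5
  spectrumᴱ 0F = Κ (+ 0)
  spectrumᴱ 1F = Ι 1F ⊕ Ι 2F ⊕ Ι 3F ⊕ Ι (suc 3F)
  spectrumᴱ 2F = Ι 2F ⊕ Ι 3F ⊕ Ι (suc 3F)
  spectrumᴱ 3F = Ι 2F

-- The comaximal graph

adjacency≡𝟙 : ∀ n (x y : Fin n) → adjacency n x y ≡ 𝟙 (adjacent? n x y)
adjacency≡𝟙 n x y with x ≟F y | comaximal? n x y
... | yes _ | yes _ = refl
... | yes _ | no _ = refl
... | no _ | yes _ = refl
... | no _ | no _ = refl

module ComaximalGraph {m : ℕ} (1<n : 1 ℕ.< ℕ.suc m) (support : PrimeSupport (ℕ.suc m)) where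

  open PrimeSupport support

  private
    n : ℕ
    n = ℕ.suc m

  kind : Fin n → Kind
  kind x = does (P ∣? toℕ x) , does (Q ∣? toℕ x)

  NoCommonPrime : Fin n → Fin n → Set
  NoCommonPrime x y = ¬ (P ∣ toℕ x × P ∣ toℕ y) × ¬ (Q ∣ toℕ x × Q ∣ toℕ y)

  noCommonPrime? : ∀ x y → Dec (NoCommonPrime x y)
  noCommonPrime? x y = ¬? (P ∣? toℕ x ×-dec P ∣? toℕ y) ×-dec ¬? (Q ∣? toℕ x ×-dec Q ∣? toℕ y)

  comaximal⇔noCommonPrime : ∀ x y → Comaximal n x y ⇔ NoCommonPrime x y
  comaximal⇔noCommonPrime x y = mk⇔
    (λ c → not-common P-prime P∣n c , not-common Q-prime Q∣n c)
    (λ (¬P , ¬Q) → coprime⇒comaximal x y λ h∣n h∣x h∣y →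
      only-P-Q h∣n (λ P∣h → ¬P (∣-trans P∣h h∣x , ∣-trans P∣h h∣y))
                   (λ Q∣h → ¬Q (∣-trans Q∣h h∣x , ∣-trans Q∣h h∣y)))
    where
    not-common : ∀ {p} → Prime p → p ∣ n → Comaximal n x y → ¬ (p ∣ toℕ x × p ∣ toℕ y)
    not-common p-prime p∣n c (p∣x , p∣y) =
      ¬prime[1] (subst Prime (∣1⇒≡1 (comaximal⇒coprime 1<n c p∣n p∣x p∣y)) p-prime)

  adjacency≡kernel : ∀ x y → adjacency n x y ≡ (+ 1 - δ x y) * kernel (kind x) (kind y)
  adjacency≡kernel x y = begin
    adjacency n x y                            ≡⟨ adjacency≡𝟙 n x y ⟩
    𝟙 (adjacent? n x y)                        ≡⟨ 𝟙-¬×-dec (x ≟F y) (comaximal? n x y) ⟩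
    (+ 1 - 𝟙 (x ≟F y)) * 𝟙 (comaximal? n x y) ≡⟨ cong₂ (λ a b → (+ 1 - a) * b) (sym (δ≡𝟙 x y)) comaximal≡kernel ⟩
    (+ 1 - δ x y) * kernel (kind x) (kind y)   ∎
    where
    open ≡-Reasoning
    comaximal≡kernel : 𝟙 (comaximal? n x y) ≡ kernel (kind x) (kind y)
    comaximal≡kernel = 𝟙-⇔ (comaximal⇔noCommonPrime x y) (comaximal? n x y) (noCommonPrime? x y)

  kernelSum : Kind → ℤ
  kernelSum κ = sumFin (λ y → kernel κ (kind y))

  degree≡ : ∀ x → degree n x ≡ kernelSum (kind x) - kernel (kind x) (kind x)
  degree≡ x = begin
    sumFin (adjacency n x)
      ≡⟨ Σ-cong (λ y → trans (adjacency≡kernel x y) (split (δ x y) (K y))) ⟩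
    sumFin (λ y → K y + - (δ x y * K y))
      ≡⟨ Σ-distrib-+ K (λ y → - (δ x y * K y)) ⟩
    kernelSum (kind x) + sumFin (λ y → - (δ x y * K y))
      ≡⟨ cong (_+_ (kernelSum (kind x))) (trans (Σ-cong (λ y → sym (ℤP.-1*i≡-i (δ x y * K y))))
                                       (trans (sym (*-distribˡ-Σ (- + 1) (λ y → δ x y * K y))) (ℤP.-1*i≡-i _))) ⟩
    kernelSum (kind x) - sumFin (λ y → δ x y * K y)
      ≡⟨ cong (λ z → kernelSum (kind x) - z) (trans (Σ-single (λ y → δ x y * K y) x off-x) on-x) ⟩
    kernelSum (kind x) - K x
      ∎
    where
    open ≡-Reasoning
    K : Fin n → ℤ
    K y = kernel (kind x) (kind y)
    split : ∀ d k → (+ 1 - d) * k ≡ k + - (d * k)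
    split = solve-∀
    off-x : ∀ y → y ≢ x → δ x y * K y ≡ + 0
    off-x y y≢x rewrite δ-≢ (y≢x ∘ sym) = refl
    on-x : δ x x * K x ≡ K x
    on-x rewrite δ-refl x = ℤP.*-identityˡ (K x)

  charPoly≡typed : ∀ t → charPoly (laplacian n) t ≡ det (typed (λ κ → t - kernelSum κ) kernel kind (λ _ → + 1))
  charPoly≡typed t = det-cong entry
    where
    rearrange : ∀ t s d kxx kxy → t * d - ((s - kxx) * d - (+ 1 - d) * kxy) ≡ (t - s) * d + kxy * + 1 + (kxx * d - kxy * d)
    rearrange = solve-∀
    entry : ∀ x y → t * δ x y - laplacian n x y ≡ (t - kernelSum (kind x)) * δ x y + kernel (kind x) (kind y) * + 1
    entry x y = begin
        t * δ x y - (degree n x * δ x y - adjacency n x y)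
      ≡⟨ cong₂ (λ a b → t * δ x y - (a * δ x y - b)) (degree≡ x) (adjacency≡kernel x y) ⟩
        t * δ x y - ((kernelSum (kind x) - K x) * δ x y - (+ 1 - δ x y) * K y)
      ≡⟨ rearrange t (kernelSum (kind x)) (δ x y) (K x) (K y) ⟩
        main + (K x * δ x y - K y * δ x y)
      ≡⟨ cong (λ z → main + (z - K y * δ x y)) (δ-diagonal K x y) ⟩
        main + (K y * δ x y - K y * δ x y)
      ≡⟨ cong (_+_ main) (ℤP.+-inverseʳ (K y * δ x y)) ⟩
        main + + 0
      ≡⟨ ℤP.+-identityʳ main ⟩
        main
      ∎
      where
      open ≡-Reasoning
      K : Fin n → ℤ
      K z = kernel (kind x) (kind z)
      main : ℤ
      main = (t - kernelSum (kind x)) * δ x y + K y * + 1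

  integral-from-representatives :
    ∀ {r} (e : Fin r → Fin n) (reps : Fin r → Kind) (spectrum : (Fin r → ℤ) → Fin r → ℤ) →
    StrictlyIncreasing e → (∀ k → kind (e k) ≡ reps k) → (∀ {k l} → reps k ≡ reps l → k ≡ l) →
    (∀ x → ∃ λ k → kind x ≡ reps k) →
    (∀ t W → det (quotient kernel reps t W) ≡ prodFin (λ k → t - spectrum W k)) →
    LaplacianIntegral n
  integral-from-representatives {r} e reps spectrum e-inc kind-e reps-inj covers det-quotient-reps =
    overlay e (spectrum W) (kernelSum ∘ kind) , λ t → begin
      charPoly (laplacian n) t                                   ≡⟨ charPoly≡typed t ⟩
      det (typed (d t) kernel kind 𝟏)
        ≡⟨ det-typed-compress (d t) kernel kind 𝟏 e e-inc kind-e-inj covers′ (λ k → t - spectrum W k) (small t) ⟩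
      prodFin (overlay e (λ k → t - spectrum W k) (d t ∘ kind))
        ≡⟨ Π-cong (overlay-∘ e (_-_ t) (spectrum W) (kernelSum ∘ kind)) ⟩
      prodFin (λ x → t - overlay e (spectrum W) (kernelSum ∘ kind) x)    ∎
    where
    open ≡-Reasoning
    𝟏 : Fin n → ℤ
    𝟏 _ = + 1
    d : ℤ → Kind → ℤ
    d t κ = t - kernelSum κ
    W : Fin r → ℤ
    W k = mass kind 𝟏 (reps k)
    kind-e-inj : ∀ {k l} → kind (e k) ≡ kind (e l) → k ≡ l
    kind-e-inj {k} {l} eq = reps-inj (trans (sym (kind-e k)) (trans eq (kind-e l)))
    covers′ : ∀ x → ∃ λ k → kind x ≡ kind (e k)
    covers′ x = proj₁ (covers x) , trans (proj₂ (covers x)) (sym (kind-e _))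
    kernelSum≡ : ∀ κ → kernelSum κ ≡ sumFin (λ l → kernel κ (reps l) * W l)
    kernelSum≡ κ = trans (Σ-cong (λ y → sym (ℤP.*-identityʳ (kernel κ (kind y)))))
      (trans (Σ-by-type kind 𝟏 e kind-e-inj covers′ (kernel κ))
             (Σ-cong (λ l → cong (λ c → kernel κ c * mass kind 𝟏 c) (kind-e l))))
    small : ∀ t → det (typed (d t) kernel (kind ∘ e) (mass kind 𝟏 ∘ kind ∘ e)) ≡ prodFin (λ k → t - spectrum W k)
    small t = trans (det-cong entries) (det-quotient-reps t W)
      where
      entries : ∀ r s → typed (d t) kernel (kind ∘ e) (mass kind 𝟏 ∘ kind ∘ e) r s ≡ quotient kernel reps t W r s
      entries r s = trans (cong₂ (λ a b → (t - kernelSum a) * δ r s + kernel a b * mass kind 𝟏 b) (kind-e r) (kind-e s))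
                          (cong (λ z → (t - z) * δ r s + kernel (reps r) (reps s) * W s) (kernelSum≡ (reps r)))

  private
    one : Fin n
    one = fromℕ< 1<n

    prime∤1 : ∀ {p} → Prime p → ¬ p ∣ 1
    prime∤1 p-prime p∣1 = ¬prime[1] (subst Prime (∣1⇒≡1 p∣1) p-prime)

    kind-at : ∀ {v} (v<n : v ℕ.< n) → kind (fromℕ< v<n) ≡ (does (P ∣? v) , does (Q ∣? v))
    kind-at v<n = cong (λ z → does (P ∣? z) , does (Q ∣? z)) (toℕ-fromℕ< v<n)

    kind-zero : kind zero ≡ both
    kind-zero = cong₂ _,_ (dec-true (P ∣? 0) (P ∣0)) (dec-true (Q ∣? 0) (Q ∣0))

    kind-one : kind one ≡ unit
    kind-one = trans (kind-at 1<n) (cong₂ _,_ (dec-false (P ∣? 1) (prime∤1 P-prime)) (dec-false (Q ∣? 1) (prime∤1 Q-prime)))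

    zero<one : zero {m} Fin.< one
    zero<one = subst (0 ℕ.<_) (sym (toℕ-fromℕ< 1<n)) ℕ.z<s

  one-prime : P ≡ Q → LaplacianIntegral n
  one-prime P≡Q = integral-from-representatives e kinds₂ spectrum₂ e-inc kind-e kinds₂-injective covers det-quotient₂
    where
    e : Fin 2 → Fin n
    e 0F = zero
    e 1F = one
    e-inc : StrictlyIncreasing e
    e-inc = increasing-by-steps λ { 0F → zero<one }
    kind-e : ∀ k → kind (e k) ≡ kinds₂ k
    kind-e 0F = kind-zero
    kind-e 1F = kind-one
    covers : ∀ x → ∃ λ k → kind x ≡ kinds₂ k
    covers x with P ∣? toℕ x | Q ∣? toℕ x
    ... | yes _ | yes _ = 0F , refl
    ... | no _ | no _ = 1F , refl
    ... | yes P∣x | no Q∤x = ⊥-elim (Q∤x (subst (_∣ toℕ x) P≡Q P∣x))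
    ... | no P∤x | yes Q∣x = ⊥-elim (P∤x (subst (_∣ toℕ x) (sym P≡Q) Q∣x))

  two-primes : P ℕ.< Q → LaplacianIntegral n
  two-primes P<Q = integral-from-representatives e kinds₄ spectrum₄ e-inc kind-e kinds₄-injective covers det-quotient₄
    where
    P∤Q : ¬ P ∣ Q
    P∤Q P∣Q with prime⇒irreducible Q-prime P∣Q
    ... | inj₁ P≡1 = ¬prime[1] (subst Prime P≡1 P-prime)
    ... | inj₂ P≡Q = ℕP.<-irrefl P≡Q P<Q
    Q∤P : ¬ Q ∣ P
    Q∤P Q∣P = ℕP.<⇒≱ P<Q (∣⇒≤ {{prime⇒nonZero P-prime}} Q∣P)
    Q<n : Q ℕ.< n
    Q<n = ℕP.≤∧≢⇒< (∣⇒≤ Q∣n) (λ Q≡n → P∤Q (subst (P ∣_) (sym Q≡n) P∣n))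
    P<n : P ℕ.< n
    P<n = ℕP.<-trans P<Q Q<n
    e : Fin 4 → Fin n
    e 0F = zero
    e 1F = one
    e 2F = fromℕ< P<n
    e 3F = fromℕ< Q<n
    e-inc : StrictlyIncreasing e
    e-inc = increasing-by-steps λ
      { 0F → zero<one
      ; 1F → subst₂ ℕ._<_ (sym (toℕ-fromℕ< 1<n)) (sym (toℕ-fromℕ< P<n)) (nonTrivial⇒n>1 P {{prime⇒nonTrivial P-prime}})
      ; 2F → subst₂ ℕ._<_ (sym (toℕ-fromℕ< P<n)) (sym (toℕ-fromℕ< Q<n)) P<Q
      }
    kind-e : ∀ k → kind (e k) ≡ kinds₄ k
    kind-e 0F = kind-zero
    kind-e 1F = kind-one
    kind-e 2F = trans (kind-at P<n) (cong₂ _,_ (dec-true (P ∣? P) ∣-refl) (dec-false (Q ∣? P) Q∤P))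
    kind-e 3F = trans (kind-at Q<n) (cong₂ _,_ (dec-false (P ∣? Q) P∤Q) (dec-true (Q ∣? Q) ∣-refl))
    covers : ∀ x → ∃ λ k → kind x ≡ kinds₄ k
    covers x = index₄ (kind x) , sym (kinds₄-index₄ (kind x))

  laplacian-integral : LaplacianIntegral n
  laplacian-integral with ℕP.m≤n⇒m<n∨m≡n P≤Q
  ... | inj₁ P<Q = two-primes P<Q
  ... | inj₂ P≡Q = one-prime P≡Q

theorem3p13 : (n p q α β : ℕ) → 2 ℕ.< n → Prime p → Prime q →
              n ≡ p ^ α ℕ.* q ^ β → LaplacianIntegral n
theorem3p13 (ℕ.suc m) p q α β 2<n p-prime q-prime n≡pᵅqᵝ =
  ComaximalGraph.laplacian-integral 1<n (prime-support α β 1<n p-prime q-prime n≡pᵅqᵝ)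
  where
  1<n : 1 ℕ.< ℕ.suc m
  1<n = ℕP.<-trans (ℕP.n<1+n 1) 2<n
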